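{- Let $G$ and $H$ be finite vertex transitive graphs, where $H$ is a Kneser graph, a circular complete graph, a cycle, or a complete bipartite graph. Then the disjoint union $G+H$ satisfies $A(G+H)=a(G+H)=\max\{A(G),A(H)\}$.
   Context: Tensor product $G\times H$: vertex set $V(G)\times V(H)$, $(u,v)\sim(u',v')$ iff $uu'\in E(G)$ and $vv'\in E(H)$; $G^n$ is the $n$-fold tensor power. $i(G)=\alpha(G)/|V(G)|$, $A(G)=\lim_{n\to\infty} i(G^n)$. $N(I)$ is the set of vertices with a neighbor in $I$; $a(G)=\max_I \frac{|I|}{|I|+|N(I)|}$ over nonempty independent sets $I$. $G+H$ denotes the disjoint union. The circular complete graph $K_{n/d}$ ($n\ge 2d$) has vertex set $\{0,\dots,n-1\}$ with $i\sim j$ iff $d\le |i-j|\le n-d$. The Kneser graph $KN_{n,k}$ ($k\le n$) has the $k$-subsets of $\{1,\dots,n\}$ as vertices, two adjacent iff disjoint. -}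

module Defs where

open import Data.Bool using (Bool; true; false; _∧_; _∨_; if_then_else_)
open import Data.Bool.Properties using (∧-comm)
open import Data.Nat as ℕ using (ℕ; zero; suc; _+_; _*_; _∸_; ∣_-_∣)
open import Data.Fin using (Fin; splitAt; remQuot; toℕ)
open import Data.Fin.Subset using (Subset; _∈_; _∩_; ∣_∣; Nonempty; inside; outside)
import Data.Fin.Subset as Sub
open import Data.Fin.Permutation using (Permutation′; _⟨$⟩ʳ_)
open import Data.Vec using (tabulate; lookup)
open import Data.List using (allFin)
open import Data.Bool.ListAction using (any)
open import Data.Sum using (_⊎_; inj₁; inj₂)
open import Data.Product using (Σ; ∃; _×_; _,_; proj₁; proj₂)
open import Data.Integer using (+_)
open import Data.Rational using (ℚ; _/_; 0ℚ; _<_; _≤_; _⊔_) renaming (∣_∣ to absℚ; _-_ to _-ℚ_)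
open import Relation.Binary.PropositionalEquality using (_≡_; refl; cong₂)
open import Relation.Nullary using (¬_)

record Graph : Set where
  field
    size  : ℕ
    adj   : Fin size → Fin size → Bool
    sym   : ∀ u v → adj u v ≡ adj v u
    loopless : ∀ v → adj v v ≡ false
open Graph public

tensor : Graph → Graph → Graph
tensor G H = record
  { size = size G * size H
  ; adj = λ x y → adjT (remQuot (size H) x) (remQuot (size H) y)
  ; sym = λ x y → symT (remQuot (size H) x) (remQuot (size H) y)
  ; loopless = λ x → irrT (remQuot (size H) x)
  }
  where
  adjT : Fin (size G) × Fin (size H) → Fin (size G) × Fin (size H) → Bool
  adjT (u , v) (u' , v') = adj G u u' ∧ adj H v v'
  symT : ∀ p q → adjT p q ≡ adjT q p
  symT (u , v) (u' , v') = cong₂ _∧_ (sym G u u') (sym H v v')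
  irrT : ∀ p → adjT p p ≡ false
  irrT (u , v) with adj G u u | loopless G u
  ... | false | refl = refl

-- Tensor powers: power G n = G^(n+1)  (G^1 = G, G^(n+2) = G^(n+1) × G)
power : Graph → ℕ → Graph
power G zero    = G
power G (suc n) = tensor (power G n) G

union : Graph → Graph → Graph
union G H = record
  { size = size G + size H
  ; adj = λ x y → adjU (splitAt (size G) x) (splitAt (size G) y)
  ; sym = λ x y → symU (splitAt (size G) x) (splitAt (size G) y)
  ; loopless = λ x → irrU (splitAt (size G) x)
  }
  where
  adjU : Fin (size G) ⊎ Fin (size H) → Fin (size G) ⊎ Fin (size H) → Bool
  adjU (inj₁ u) (inj₁ u') = adj G u u'
  adjU (inj₂ v) (inj₂ v') = adj H v v'
  adjU _ _ = false
  symU : ∀ p q → adjU p q ≡ adjU q p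
  symU (inj₁ u) (inj₁ u') = sym G u u'
  symU (inj₁ u) (inj₂ v') = refl
  symU (inj₂ v) (inj₁ u') = refl
  symU (inj₂ v) (inj₂ v') = sym H v v'
  irrU : ∀ p → adjU p p ≡ false
  irrU (inj₁ u) = loopless G u
  irrU (inj₂ v) = loopless H v

Independent : (G : Graph) → Subset (size G) → Set
Independent G I = ∀ u v → u ∈ I → v ∈ I → adj G u v ≡ false

N : (G : Graph) → Subset (size G) → Subset (size G)
N G I = tabulate λ w → any (λ u → lookup I u ∧ adj G u w) (allFin (size G))

IsAlpha : Graph → ℕ → Set
IsAlpha G k = (∃ λ I → Independent G I × ∣ I ∣ ≡ k)
            × (∀ I → Independent G I → ∣ I ∣ ℕ.≤ k)

-- a / b as a rational (b = 0 never occurs below for nonempty graphs)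
frac : ℕ → ℕ → ℚ
frac a zero    = 0ℚ
frac a (suc b) = (+ a) / suc b

ConvergesTo : (ℕ → ℚ) → ℚ → Set
ConvergesTo f q = ∀ ε → 0ℚ < ε → ∃ λ M → ∀ n → M ℕ.≤ n → absℚ (f n -ℚ q) < ε

-- A(G) = q : i(G^n) = α(G^n)/|V(G^n)| → q as n → ∞
-- (the sequence is indexed by n ↦ G^(n+1); shifting the index does not change the limit)
HasA : Graph → ℚ → Set
HasA G q = ∀ ε → 0ℚ < ε → ∃ λ M → ∀ n → M ℕ.≤ n → ∀ k →
           IsAlpha (power G n) k → absℚ (frac k (size (power G n)) -ℚ q) < ε

ratio : (G : Graph) → Subset (size G) → ℚ
ratio G I = frac ∣ I ∣ (∣ I ∣ + ∣ N G I ∣)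

Hasa : Graph → ℚ → Set
Hasa G q = (∃ λ I → Independent G I × Nonempty I × ratio G I ≡ q)
         × (∀ I → Independent G I → Nonempty I → ratio G I ≤ q)

VertexTransitive : Graph → Set
VertexTransitive G = ∀ u v → ∃ λ (σ : Permutation′ (size G)) →
  (∀ x y → adj G (σ ⟨$⟩ʳ x) (σ ⟨$⟩ʳ y) ≡ adj G x y) × (σ ⟨$⟩ʳ u ≡ v)

IsoTo : (G : Graph) (W : Set) → (W → W → Set) → Set
IsoTo G W R = ∃ λ (f : Fin (size G) → W) →
    (∀ {x y} → f x ≡ f y → x ≡ y)
  × (∀ w → ∃ λ x → f x ≡ w)
  × (∀ u v → (adj G u v ≡ true → R (f u) (f v)) × (R (f u) (f v) → adj G u v ≡ true))

KneserVertex : ℕ → ℕ → Set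
KneserVertex n k = Σ (Subset n) λ S → ∣ S ∣ ≡ k

KneserAdj : ∀ {n k} → KneserVertex n k → KneserVertex n k → Set
KneserAdj (S , _) (T , _) = S ∩ T ≡ Sub.⊥

IsKneser : Graph → Set
IsKneser G = ∃ λ n → ∃ λ k → 1 ℕ.≤ k × k ℕ.≤ n × IsoTo G (KneserVertex n k) KneserAdj

dist : ∀ {n} → Fin n → Fin n → ℕ
dist i j = ∣ toℕ i - toℕ j ∣

IsCircularComplete : Graph → Set
IsCircularComplete G = ∃ λ n → ∃ λ d → 1 ℕ.≤ d × 2 * d ℕ.≤ n ×
  IsoTo G (Fin n) (λ i j → d ℕ.≤ dist i j × dist i j ℕ.≤ n ∸ d)

IsCycle : Graph → Set
IsCycle G = ∃ λ m → 3 ℕ.≤ m ×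
  IsoTo G (Fin m) (λ i j → (dist i j ≡ 1) ⊎ (dist i j ≡ m ∸ 1))

BipAdj : ∀ {a b} → Fin a ⊎ Fin b → Fin a ⊎ Fin b → Set
BipAdj (inj₁ _) (inj₂ _) = Data.Unit.⊤ where import Data.Unit
BipAdj (inj₂ _) (inj₁ _) = Data.Unit.⊤ where import Data.Unit
BipAdj _ _ = Data.Empty.⊥ where import Data.Empty

IsCompleteBipartite : Graph → Set
IsCompleteBipartite G = ∃ λ a → ∃ λ b → IsoTo G (Fin a ⊎ Fin b) BipAdj

{-# OPTIONS --safe #-}
module Submission where

-- Call a union W of components of a graph tight with ratio p/q if no independent subset of W has
-- more than (p/q)|W| vertices, and some weighted family of independent subsets of W with at least
-- (p/q)|W| vertices each covers every vertex of W with at most the fraction p/q of the total weight.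
-- A vertex-transitive graph is tight with ratio i(G): weight all maximum independent sets equally.
-- In a tight W every independent I has |I|/(|I| + |N(I)|) ≤ p/q (exchange, inside each member of
-- the family, the part meeting the closed neighbourhood of I for I itself), and with this bound
-- tensor products with a tight factor, and disjoint unions of tight sets of equal ratio, are again
-- tight.  If i(G) ≥ i(H), the power U^n of U = G + H splits into H^n, tight with ratio i(H), and
-- its complement, tight with ratio i(G).  Hence i(G) - (|H|/|U|)^n ≤ i(U^n) ≤ i(G), so
-- A(U) = i(G); and a maximum independent set J of G has |J| + |N(J)| = |G|, so it attains
-- a(U) = i(G).  The same argument with H empty gives A(G) = i(G).

open import Defs
open import Data.Nat using (NonZero)
open import Data.Sum using (_⊎_)
open import Data.Product using (∃; _×_)
open import Data.Rational using (_⊔_)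

open import Data.Nat.Properties
open import Algebra.Properties.Semiring.Sum +-*-semiring
  using (sum; sum-cong-≗; ∑-distrib-+; ∑-comm; sum-permute; *-distribˡ-sum; *-distribʳ-sum)
open import Data.Bool using (Bool; true; false; _∧_; _∨_; not)
import Data.Bool.Properties as Bool
open import Data.Bool.Properties
  using (T-≡; ∧-conicalˡ; ∧-conicalʳ; ∧-zeroʳ; ∧-identityʳ; ∧-identityˡ; ∨-identityʳ)
open import Data.Bool.ListAction using (any)
open import Data.Empty using (⊥; ⊥-elim)
open import Data.Fin using (Fin; zero; suc; splitAt; remQuot; combine; _↑ˡ_; _↑ʳ_; finToFun; funToFin; fromℕ<)
import Data.Fin.Properties as Fin
open import Data.Fin.Properties
  using ( remQuot-combine; splitAt-↑ˡ; splitAt-↑ʳ; splitAt⁻¹-↑ˡ; splitAt⁻¹-↑ʳ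
        ; 2↔Bool; finToFun-funToFin; funToFin-finToFin; all?)
open import Data.Fin.Permutation using (Permutation′; _⟨$⟩ʳ_; _⟨$⟩ˡ_; permutation; inverseˡ; inverseʳ; flip)
open import Data.Fin.Subset using (Subset; ∣_∣; Nonempty)
import Data.Integer as ℤ
import Data.Integer.Properties as ℤ
open import Data.List using (List; allFin; filter)
open import Data.List.Extrema.Nat using (argmax; argmax-all; f[xs]≤f[argmax])
open import Data.List.Membership.Propositional using (lose)
open import Data.List.Membership.Propositional.Properties using (∈-allFin; ∈-filter⁺)
import Data.List.Relation.Unary.All as All
open import Data.List.Relation.Unary.All.Properties using (all-filter)
open import Data.List.Relation.Unary.Any using (satisfied)
open import Data.List.Relation.Unary.Any.Properties using (any⁺; any⁻)
open import Data.Nat using (ℕ; zero; suc; _+_; _*_; _∸_; _^_; _≤_; _<_; z≤n; s≤s; >-nonZero; >-nonZero⁻¹)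
open import Data.Nat.Solver using (module +-*-Solver)
open import Data.Product using (_,_; proj₁; proj₂)
open import Data.Rational as ℚ using (ℚ; mkℚ; 0ℚ)
  renaming (_≤_ to _≤ℚ_; _<_ to _<ℚ_; _-_ to _-ℚ_; ∣_∣ to ∣_∣ℚ)
import Data.Rational.Properties as ℚ
open import Data.Rational.Unnormalised as ℚᵘ using (mkℚᵘ)
import Data.Rational.Unnormalised.Properties as ℚᵘ
open import Data.Sum using (inj₁; inj₂; [_,_]′)
open import Data.Vec using ([]; _∷_; lookup; tabulate)
open import Data.Vec.Properties using (lookup∘tabulate; lookup⇒[]=; []=⇒lookup)
open import Function using (_∘_; Inverse; Equivalence; mk⇔)
open import Relation.Binary.PropositionalEquality as ≡ using (_≡_; refl; cong; cong₂; _≗_)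
open import Relation.Nullary using (Dec; yes; no; does)
open import Relation.Nullary.Decidable using (_×-dec_; _→-dec_; dec-true; does-⇔)
open import Relation.Unary using (Decidable)

open +-*-Solver using (solve; _:+_; _:*_; _:=_; con)

sum-mono-≤ : ∀ {n} {f g : Fin n → ℕ} → (∀ i → f i ≤ g i) → sum f ≤ sum g
sum-mono-≤ {zero}  _   = z≤n
sum-mono-≤ {suc n} f≤g = +-mono-≤ (f≤g zero) (sum-mono-≤ (f≤g ∘ suc))

≤-sum : ∀ {n} (f : Fin n → ℕ) i → f i ≤ sum f
≤-sum f zero    = m≤m+n (f zero) _
≤-sum f (suc i) = ≤-trans (≤-sum (f ∘ suc) i) (m≤n+m _ (f zero))

sum-positive : ∀ {n} (f : Fin n → ℕ) → 0 < sum f → ∃ λ i → 0 < f i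
sum-positive {suc n} f pos with f zero in eq
... | suc _ = zero , ≡.subst (0 <_) (≡.sym eq) (s≤s z≤n)
... | zero  = let i , fi>0 = sum-positive (f ∘ suc) pos in suc i , fi>0

sum-++ : ∀ {m n} (f : Fin (m + n) → ℕ) → sum f ≡ sum (f ∘ (_↑ˡ n)) + sum (f ∘ (m ↑ʳ_))
sum-++ {zero}  f = refl
sum-++ {suc m} {n} f =
  ≡.trans (cong (f zero +_) (sum-++ {m} {n} (f ∘ suc))) (≡.sym (+-assoc (f zero) _ _))

sum-combine : ∀ {m n} (f : Fin (m * n) → ℕ) → sum f ≡ sum (λ i → sum (λ j → f (combine {m} {n} i j)))
sum-combine {zero}      f = refl
sum-combine {suc m} {n} f =
  ≡.trans (sum-++ {n} f) (cong (sum (f ∘ (_↑ˡ (m * n))) +_) (sum-combine {m} {n} (f ∘ (n ↑ʳ_))))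

sum-remQuot : ∀ {m n} (f : Fin m → Fin n → ℕ) →
              sum (λ k → let (i , j) = remQuot {m} n k in f i j) ≡ sum (λ i → sum (f i))
sum-remQuot {m} {n} f = ≡.trans (sum-combine {m} {n} _)
  (sum-cong-≗ λ i → sum-cong-≗ λ j → cong (λ (i , j) → f i j) (remQuot-combine {m} {n} i j))

sum-*-sum : ∀ {m n} (f : Fin m → ℕ) (g : Fin n → ℕ) →
            sum (λ t → sum (λ s → f t * g s)) ≡ sum f * sum g
sum-*-sum f g =
  ≡.trans (sum-cong-≗ λ t → ≡.sym (*-distribˡ-sum (f t) g)) (≡.sym (*-distribʳ-sum (sum g) f))

sum-const : ∀ {n} c → sum {n} (λ _ → c) ≡ n * c
sum-const {zero}  c = refl
sum-const {suc n} c = cong (c +_) (sum-const {n} c)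

sum₂-distrib-+ : ∀ {m n} (f g : Fin m → Fin n → ℕ) →
  sum (λ x → sum (λ y → f x y + g x y)) ≡ sum (λ x → sum (f x)) + sum (λ x → sum (g x))
sum₂-distrib-+ f g =
  ≡.trans (sum-cong-≗ λ x → ∑-distrib-+ (f x) (g x)) (∑-distrib-+ (λ x → sum (f x)) (λ x → sum (g x)))

sum-pairs : ∀ {m n} (w₁ : Fin m → ℕ) (w₂ : Fin n → ℕ) →
            sum (λ k → let (t , s) = remQuot {m} n k in w₁ t * w₂ s) ≡ sum w₁ * sum w₂
sum-pairs {m} w₁ w₂ = ≡.trans (sum-remQuot {m} (λ t s → w₁ t * w₂ s)) (sum-*-sum w₁ w₂)

-- The load of the pair family (t , s) ↦ w₁ t * w₂ s at a vertex that only the first (second)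
-- factor can contain.
module _ {m n} (w₁ : Fin m → ℕ) (w₂ : Fin n → ℕ) (f : Fin m → Fin n → ℕ) {p q : ℕ} where

  private
    pairs : (Fin m → Fin n → ℕ) → ℕ
    pairs g = sum (λ k → let (t , s) = remQuot {m} n k in g t s)

  sum-pairs-≤ˡ : (a : Fin m → ℕ) → (∀ t s → w₁ t * w₂ s * f t s ≡ w₁ t * a t * w₂ s) →
                 sum (λ t → w₁ t * a t) * q ≤ p * sum w₁ →
                 pairs (λ t s → w₁ t * w₂ s * f t s) * q ≤ p * pairs (λ t s → w₁ t * w₂ s)
  sum-pairs-≤ˡ a pointwise bound = begin
    pairs (λ t s → w₁ t * w₂ s * f t s) * q
      ≡⟨ cong (_* q) (sum-remQuot {m} (λ t s → w₁ t * w₂ s * f t s)) ⟩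
    sum (λ t → sum (λ s → w₁ t * w₂ s * f t s)) * q
      ≡⟨ cong (_* q) (≡.trans (sum-cong-≗ λ t → sum-cong-≗ (pointwise t)) (sum-*-sum (λ t → w₁ t * a t) w₂)) ⟩
    sum (λ t → w₁ t * a t) * sum w₂ * q
      ≡⟨ solve 3 (λ x y q → x :* y :* q := x :* q :* y) refl (sum (λ t → w₁ t * a t)) (sum w₂) q ⟩
    sum (λ t → w₁ t * a t) * q * sum w₂
      ≤⟨ *-monoˡ-≤ (sum w₂) bound ⟩
    p * sum w₁ * sum w₂
      ≡⟨ ≡.trans (*-assoc p (sum w₁) (sum w₂)) (cong (p *_) (≡.sym (sum-pairs w₁ w₂))) ⟩
    p * pairs (λ t s → w₁ t * w₂ s) ∎
    where open ≤-Reasoning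

  sum-pairs-≤ʳ : (b : Fin n → ℕ) → (∀ t s → w₁ t * w₂ s * f t s ≡ w₁ t * (w₂ s * b s)) →
                 sum (λ s → w₂ s * b s) * q ≤ p * sum w₂ →
                 pairs (λ t s → w₁ t * w₂ s * f t s) * q ≤ p * pairs (λ t s → w₁ t * w₂ s)
  sum-pairs-≤ʳ b pointwise bound = begin
    pairs (λ t s → w₁ t * w₂ s * f t s) * q
      ≡⟨ cong (_* q) (sum-remQuot {m} (λ t s → w₁ t * w₂ s * f t s)) ⟩
    sum (λ t → sum (λ s → w₁ t * w₂ s * f t s)) * q
      ≡⟨ cong (_* q) (≡.trans (sum-cong-≗ λ t → sum-cong-≗ (pointwise t)) (sum-*-sum w₁ (λ s → w₂ s * b s))) ⟩
    sum w₁ * sum (λ s → w₂ s * b s) * q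
      ≡⟨ *-assoc (sum w₁) (sum (λ s → w₂ s * b s)) q ⟩
    sum w₁ * (sum (λ s → w₂ s * b s) * q)
      ≤⟨ *-monoʳ-≤ (sum w₁) bound ⟩
    sum w₁ * (p * sum w₂)
      ≡⟨ ≡.trans (solve 3 (λ x p y → x :* (p :* y) := p :* (x :* y)) refl (sum w₁) p (sum w₂))
                 (cong (p *_) (≡.sym (sum-pairs w₁ w₂))) ⟩
    p * pairs (λ t s → w₁ t * w₂ s) ∎
    where open ≤-Reasoning

-- Vertex sets are Boolean functions rather than the Subset vectors of Defs; card, Independent′
-- and N′ below correspond to ∣_∣, Independent and N (see card-lookup and Independent⇒Independent′).
VSet : ℕ → Set
VSet n = Fin n → Bool

⟦_⟧ : Bool → ℕ
⟦ true  ⟧ = 1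
⟦ false ⟧ = 0

card : ∀ {n} → VSet n → ℕ
card P = sum (λ x → ⟦ P x ⟧)

∅ full : ∀ {n} → VSet n
∅    _ = false
full _ = true

infixr 6 _∪_
infixr 7 _∩_
_∪_ _∩_ : ∀ {n} → VSet n → VSet n → VSet n
(A ∪ B) x = A x ∨ B x
(A ∩ B) x = A x ∧ B x

_∖_ : ∀ {n} → VSet n → VSet n → VSet n
(A ∖ B) x = A x ∧ not (B x)

infix 4 _⊆_
_⊆_ : ∀ {n} → VSet n → VSet n → Set
A ⊆ B = ∀ x → A x ≡ true → B x ≡ true

Disjoint : ∀ {n} → VSet n → VSet n → Set
Disjoint A B = ∀ x → A x ≡ true → B x ≡ false

∨-elim : ∀ a b → a ∨ b ≡ true → a ≡ true ⊎ b ≡ true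
∨-elim true  _ _ = inj₁ refl
∨-elim false _ e = inj₂ e

∨-introˡ : ∀ {a} b → a ≡ true → a ∨ b ≡ true
∨-introˡ _ refl = refl

∨-introʳ : ∀ a {b} → b ≡ true → a ∨ b ≡ true
∨-introʳ true  _    = refl
∨-introʳ false refl = refl

∧-intro : ∀ {a b} → a ≡ true → b ≡ true → a ∧ b ≡ true
∧-intro refl refl = refl

∖-elim : ∀ a b → a ∧ not b ≡ true → a ≡ true × b ≡ false
∖-elim true false _ = refl , refl

true≢false : true ≡ false → ⊥
true≢false ()

⟦∧⟧ : ∀ a b → ⟦ a ∧ b ⟧ ≡ ⟦ a ⟧ * ⟦ b ⟧
⟦∧⟧ true  b = ≡.sym (+-identityʳ ⟦ b ⟧)
⟦∧⟧ false b = refl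

card-cong : ∀ {n} {A B : VSet n} → A ≗ B → card A ≡ card B
card-cong A≗B = sum-cong-≗ (cong ⟦_⟧ ∘ A≗B)

card-∅ : ∀ {n} → card (∅ {n}) ≡ 0
card-∅ {zero}  = refl
card-∅ {suc n} = card-∅ {n}

card-full : ∀ {n} → card (full {n}) ≡ n
card-full {zero}  = refl
card-full {suc n} = cong suc (card-full {n})

card-∪ : ∀ {n} {A B : VSet n} → Disjoint A B → card (A ∪ B) ≡ card A + card B
card-∪ {A = A} {B} disj =
  ≡.trans (sum-cong-≗ λ x → pointwise (A x) (B x) (disj x)) (∑-distrib-+ (λ x → ⟦ A x ⟧) (λ x → ⟦ B x ⟧))
  where
  pointwise : ∀ a b → (a ≡ true → b ≡ false) → ⟦ a ∨ b ⟧ ≡ ⟦ a ⟧ + ⟦ b ⟧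
  pointwise true  b h rewrite h refl = refl
  pointwise false b h = refl

card-mono : ∀ {n} {A B : VSet n} → A ⊆ B → card A ≤ card B
card-mono {A = A} {B} A⊆B = sum-mono-≤ λ x → pointwise (A x) (B x) (A⊆B x)
  where
  pointwise : ∀ a b → (a ≡ true → b ≡ true) → ⟦ a ⟧ ≤ ⟦ b ⟧
  pointwise true  b h rewrite h refl = ≤-refl
  pointwise false b h = z≤n

card≤size : ∀ {n} (A : VSet n) → card A ≤ n
card≤size {n} A = ≤-trans (card-mono {n} {A} {full} λ _ _ → refl) (≤-reflexive (card-full {n}))

card-∖-∩ : ∀ {n} (A X : VSet n) → card A ≡ card (A ∖ X) + card (A ∩ X)
card-∖-∩ A X =
  ≡.trans (sum-cong-≗ λ x → pointwise (A x) (X x)) (∑-distrib-+ (λ x → ⟦ (A ∖ X) x ⟧) (λ x → ⟦ (A ∩ X) x ⟧))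
  where
  pointwise : ∀ a b → ⟦ a ⟧ ≡ ⟦ a ∧ not b ⟧ + ⟦ a ∧ b ⟧
  pointwise true  true  = refl
  pointwise true  false = refl
  pointwise false b     = refl

card-positive : ∀ {n} (A : VSet n) → 0 < card A → ∃ λ x → A x ≡ true
card-positive A pos with sum-positive (λ x → ⟦ A x ⟧) pos
... | x , Ax>0 = x , pointwise (A x) Ax>0
  where
  pointwise : ∀ a → 0 < ⟦ a ⟧ → a ≡ true
  pointwise true _ = refl

Independent′ : (K : Graph) → VSet (size K) → Set
Independent′ K I = ∀ u v → I u ≡ true → I v ≡ true → adj K u v ≡ false

N′ : (K : Graph) → VSet (size K) → VSet (size K)
N′ K I w = any (λ u → I u ∧ adj K u w) (allFin (size K))

Closed : (K : Graph) → VSet (size K) → Set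
Closed K W = ∀ u v → W u ≡ true → adj K u v ≡ true → W v ≡ true

N′-intro : ∀ K I u w → I u ≡ true → adj K u w ≡ true → N′ K I w ≡ true
N′-intro K I u w Iu uw = Equivalence.to T-≡
  (any⁺ {xs = allFin (size K)} _ (lose (∈-allFin u) (Equivalence.from T-≡ (∧-intro Iu uw))))

N′-elim : ∀ K I w → N′ K I w ≡ true → ∃ λ u → I u ≡ true × adj K u w ≡ true
N′-elim K I w e with satisfied (any⁻ _ (allFin (size K)) (Equivalence.from T-≡ e))
... | u , Tuw = u , ∧-conicalˡ _ _ uw , ∧-conicalʳ _ _ uw
  where uw = Equivalence.to T-≡ Tuw

N′-mono : ∀ K {A B} → A ⊆ B → N′ K A ⊆ N′ K B
N′-mono K {A} {B} A⊆B w e with N′-elim K A w e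
... | u , Au , uw = N′-intro K B u w (A⊆B u Au) uw

N′-disjoint : ∀ K {I} → Independent′ K I → Disjoint I (N′ K I)
N′-disjoint K {I} ind x Ix with N′ K I x in e
... | false = refl
... | true with N′-elim K I x e
... | u , Iu , ux = ⊥-elim (true≢false (≡.trans (≡.sym ux) (ind u x Iu Ix)))

N′-closed : ∀ K {W I} → Closed K W → I ⊆ W → N′ K I ⊆ W
N′-closed K {W} {I} cl I⊆W x e with N′-elim K I x e
... | u , Iu , ux = cl u x (I⊆W u Iu) ux

closedNbhd-⊆ : ∀ K {W I} → Closed K W → I ⊆ W → (I ∪ N′ K I) ⊆ W
closedNbhd-⊆ K {W} {I} cl I⊆W x e with ∨-elim (I x) _ e
... | inj₁ Ix  = I⊆W x Ix
... | inj₂ NIx = N′-closed K cl I⊆W x NIx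

card-closedNbhd : ∀ K {I} → Independent′ K I → card (I ∪ N′ K I) ≡ card I + card (N′ K I)
card-closedNbhd K ind = card-∪ (N′-disjoint K ind)

bool-ext : ∀ {a b} → (a ≡ true → b ≡ true) → (b ≡ true → a ≡ true) → a ≡ b
bool-ext {false} {false} _ _ = refl
bool-ext {false} {true}  _ g = g refl
bool-ext {true}  {false} f _ = ≡.sym (f refl)
bool-ext {true}  {true}  _ _ = refl

N′-cong : ∀ K {A B} → A ≗ B → N′ K A ≗ N′ K B
N′-cong K A≗B w = bool-ext (N′-mono K (λ x → ≡.trans (≡.sym (A≗B x))) w) (N′-mono K (λ x → ≡.trans (A≗B x)) w)

Independent′-cong : ∀ K {A B} → A ≗ B → Independent′ K A → Independent′ K B
Independent′-cong K A≗B ind u v Bu Bv = ind u v (≡.trans (A≗B u) Bu) (≡.trans (A≗B v) Bv)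

N′-∪ : ∀ K A B → N′ K (A ∪ B) ≗ N′ K A ∪ N′ K B
N′-∪ K A B w = bool-ext to from
  where
  to : N′ K (A ∪ B) w ≡ true → (N′ K A ∪ N′ K B) w ≡ true
  to e with N′-elim K (A ∪ B) w e
  ... | u , ABu , uw with ∨-elim (A u) (B u) ABu
  ... | inj₁ Au = ∨-introˡ _ (N′-intro K A u w Au uw)
  ... | inj₂ Bu = ∨-introʳ (N′ K A w) (N′-intro K B u w Bu uw)
  from : (N′ K A ∪ N′ K B) w ≡ true → N′ K (A ∪ B) w ≡ true
  from e with ∨-elim (N′ K A w) _ e
  ... | inj₁ NAw = N′-mono K (λ x → ∨-introˡ (B x)) w NAw
  ... | inj₂ NBw = N′-mono K (λ x → ∨-introʳ (A x)) w NBw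

N′-∅ : ∀ K → N′ K ∅ ≗ ∅
N′-∅ K w with N′ K ∅ w in e
... | false = refl
... | true with N′-elim K ∅ w e
...   | _ , () , _

Closed-∅ : ∀ K → Closed K ∅
Closed-∅ K u v () _

Closed-full : ∀ K → Closed K full
Closed-full K _ _ _ _ = refl

Closed-∪ : ∀ K {A B} → Closed K A → Closed K B → Closed K (A ∪ B)
Closed-∪ K {A} {B} clA clB u v ABu uv with ∨-elim (A u) _ ABu
... | inj₁ Au = ∨-introˡ _ (clA u v Au uv)
... | inj₂ Bu = ∨-introʳ (A v) (clB u v Bu uv)

Disjoint-⊆ : ∀ {n} {A B W₁ W₂ : VSet n} → A ⊆ W₁ → B ⊆ W₂ → Disjoint W₁ W₂ → Disjoint A B
Disjoint-⊆ {B = B} A⊆W₁ B⊆W₂ disj x Ax with B x in e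
... | false = refl
... | true  = ⊥-elim (true≢false (≡.trans (≡.sym (B⊆W₂ x e)) (disj x (A⊆W₁ x Ax))))

Closed-apart : ∀ K {W₁ W₂} → Closed K W₁ → Disjoint W₁ W₂ →
               ∀ {u v} → W₁ u ≡ true → W₂ v ≡ true → adj K u v ≡ false
Closed-apart K cl disj {u} {v} W₁u W₂v with adj K u v in e
... | false = refl
... | true  = ⊥-elim (true≢false (≡.trans (≡.sym W₂v) (disj v (cl u v W₁u e))))

∪-independent : ∀ K {A B W₁ W₂} → Closed K W₁ → Disjoint W₁ W₂ → A ⊆ W₁ → B ⊆ W₂ →
                Independent′ K A → Independent′ K B → Independent′ K (A ∪ B)
∪-independent K {A} cl disj A⊆W₁ B⊆W₂ indA indB u v ABu ABv
  with ∨-elim (A u) _ ABu | ∨-elim (A v) _ ABv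
... | inj₁ Au | inj₁ Av = indA u v Au Av
... | inj₂ Bu | inj₂ Bv = indB u v Bu Bv
... | inj₁ Au | inj₂ Bv = Closed-apart K cl disj (A⊆W₁ u Au) (B⊆W₂ v Bv)
... | inj₂ Bu | inj₁ Av = ≡.trans (Graph.sym K u v) (Closed-apart K cl disj (A⊆W₁ v Av) (B⊆W₂ u Bu))

card-lookup : ∀ {n} (S : Subset n) → ∣ S ∣ ≡ card (lookup S)
card-lookup []          = refl
card-lookup (true ∷ S)  = cong suc (card-lookup S)
card-lookup (false ∷ S) = card-lookup S

card-tabulate : ∀ {n} (P : VSet n) → ∣ tabulate P ∣ ≡ card P
card-tabulate P = ≡.trans (card-lookup (tabulate P)) (card-cong (lookup∘tabulate P))

Independent⇒Independent′ : ∀ K {I} → Independent K I → Independent′ K (lookup I)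
Independent⇒Independent′ K {I} ind u v Iu Iv = ind u v (lookup⇒[]= u I Iu) (lookup⇒[]= v I Iv)

Independent′⇒Independent : ∀ K {P} → Independent′ K P → Independent K (tabulate P)
Independent′⇒Independent K {P} ind u v Pu Pv =
  ind u v (≡.trans (≡.sym (lookup∘tabulate P u)) ([]=⇒lookup Pu))
          (≡.trans (≡.sym (lookup∘tabulate P v)) ([]=⇒lookup Pv))

Nonempty⇒card-positive : ∀ {n} (I : Subset n) → Nonempty I → 0 < card (lookup I)
Nonempty⇒card-positive I (x , x∈I) =
  ≤-trans (≤-reflexive (cong ⟦_⟧ (≡.sym ([]=⇒lookup x∈I)))) (≤-sum (λ y → ⟦ lookup I y ⟧) x)

-- Tight vertex sets

-- A pair p q stands for the ratio p/q.
NbhdRatio≤ IndepRatio≤ : ℕ → ℕ → (K : Graph) → VSet (size K) → Set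
NbhdRatio≤ p q K W = ∀ I → Independent′ K I → I ⊆ W → card I * q ≤ p * (card I + card (N′ K I))
IndepRatio≤ p q K W = ∀ I → Independent′ K I → I ⊆ W → card I * q ≤ p * card W

record FractionalCover (p q : ℕ) (K : Graph) (W : VSet (size K)) : Set where
  field
    count           : ℕ
    member          : Fin count → VSet (size K)
    weight          : Fin count → ℕ
    weight-positive : 0 < sum weight
    member-large    : ∀ t → weight t ≡ 0 ⊎
                      (Independent′ K (member t) × member t ⊆ W × p * card W ≤ card (member t) * q)
    load            : ∀ x → W x ≡ true → sum (λ t → weight t * ⟦ member t x ⟧) * q ≤ p * sum weight

  vanishes-outside : ∀ {x} → W x ≡ false → ∀ t → weight t * ⟦ member t x ⟧ ≡ 0
  vanishes-outside {x} Wx≡false t with member-large t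
  ... | inj₁ wt≡0 rewrite wt≡0 = refl
  ... | inj₂ (_ , J⊆W , _) with member t x in e
  ...   | false = *-zeroʳ (weight t)
  ...   | true  = ⊥-elim (true≢false (≡.trans (≡.sym (J⊆W x e)) Wx≡false))

  large-member : ∃ λ J → Independent′ K J × J ⊆ W × p * card W ≤ card J * q
  large-member with sum-positive weight weight-positive
  ... | t , wt>0 with member-large t
  ...   | inj₁ wt≡0 = ⊥-elim (<-irrefl (≡.sym wt≡0) wt>0)
  ...   | inj₂ large = member t , large

Tight : ℕ → ℕ → (K : Graph) → VSet (size K) → Set
Tight p q K W = IndepRatio≤ p q K W × FractionalCover p q K W

nbhdRatio≤⇒indepRatio≤ : ∀ {p q K W} → Closed K W → NbhdRatio≤ p q K W → IndepRatio≤ p q K W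
nbhdRatio≤⇒indepRatio≤ {p} {K = K} cl bound I ind I⊆W = ≤-trans (bound I ind I⊆W)
  (*-monoʳ-≤ p (≤-trans (≤-reflexive (≡.sym (card-closedNbhd K ind))) (card-mono (closedNbhd-⊆ K cl I⊆W))))

NbhdRatio≤-mono : ∀ {p p′ q K W} → p ≤ p′ → NbhdRatio≤ p q K W → NbhdRatio≤ p′ q K W
NbhdRatio≤-mono p≤p′ bound I ind I⊆W = ≤-trans (bound I ind I⊆W) (*-monoˡ-≤ _ p≤p′)

closedNbhd-apart : ∀ K {I u v} → I u ≡ true → (I ∪ N′ K I) v ≡ false → adj K u v ≡ false
closedNbhd-apart K {I} {u} {v} Iu Xv with adj K u v in e
... | false = refl
... | true  = ⊥-elim (true≢false (≡.trans (≡.sym (∨-introʳ (I v) (N′-intro K I u v Iu e))) Xv))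

exchange-independent : ∀ K {I J} → Independent′ K I → Independent′ K J →
                       Independent′ K ((J ∖ (I ∪ N′ K I)) ∪ I)
exchange-independent K {I} {J} indI indJ u v Tu Tv
  with ∨-elim ((J ∖ (I ∪ N′ K I)) u) (I u) Tu | ∨-elim ((J ∖ (I ∪ N′ K I)) v) (I v) Tv
... | inj₂ Iu | inj₂ Iv = indI u v Iu Iv
... | inj₁ Ju | inj₁ Jv = indJ u v (proj₁ (∖-elim (J u) _ Ju)) (proj₁ (∖-elim (J v) _ Jv))
... | inj₂ Iu | inj₁ Jv = closedNbhd-apart K Iu (proj₂ (∖-elim (J v) _ Jv))
... | inj₁ Ju | inj₂ Iv = ≡.trans (Graph.sym K u v) (closedNbhd-apart K Iv (proj₂ (∖-elim (J u) _ Ju)))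

-- Exchanging the part of J in the closed neighbourhood of I for I itself keeps J independent,
-- so a J of maximum ratio must meet the closed neighbourhood of I in at least |I| vertices.
large-independent-meets-closedNbhd :
  ∀ {p q K W I J} → 0 < q → IndepRatio≤ p q K W → Independent′ K I → I ⊆ W →
  Independent′ K J → J ⊆ W → p * card W ≤ card J * q → card I ≤ card (J ∩ (I ∪ N′ K I))
large-independent-meets-closedNbhd {p} {q} {K} {W} {I} {J} q>0 bound indI I⊆W indJ J⊆W large =
  +-cancelˡ-≤ (card (J ∖ X)) _ _ (begin
    card (J ∖ X) + card I ≡⟨ card-∪ disjoint ⟨
    card T                ≤⟨ *-cancelʳ-≤ _ _ q {{>-nonZero q>0}} (≤-trans (bound T indT T⊆W) large) ⟩
    card J                ≡⟨ card-∖-∩ J X ⟩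
    card (J ∖ X) + card (J ∩ X) ∎)
  where
  open ≤-Reasoning
  X = I ∪ N′ K I
  T = (J ∖ X) ∪ I
  indT : Independent′ K T
  indT = exchange-independent K indI indJ
  T⊆W : T ⊆ W
  T⊆W x Tx with ∨-elim ((J ∖ X) x) (I x) Tx
  ... | inj₁ Jx = J⊆W x (proj₁ (∖-elim (J x) _ Jx))
  ... | inj₂ Ix = I⊆W x Ix
  disjoint : Disjoint (J ∖ X) I
  disjoint x Jx with I x
  ... | false = refl
  ... | true  = ⊥-elim (true≢false (proj₂ (∖-elim (J x) _ Jx)))

weighted-card-∩ : ∀ {m n} (w : Fin m → ℕ) (J : Fin m → VSet n) (X : VSet n) →
  sum (λ t → w t * card (J t ∩ X)) ≡ sum (λ x → ⟦ X x ⟧ * sum (λ t → w t * ⟦ J t x ⟧))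
weighted-card-∩ {m} {n} w J X = begin
  sum (λ t → w t * card (J t ∩ X))
    ≡⟨ sum-cong-≗ (λ t → *-distribˡ-sum (w t) (λ x → ⟦ (J t ∩ X) x ⟧)) ⟩
  sum (λ t → sum (λ x → w t * ⟦ (J t ∩ X) x ⟧))
    ≡⟨ ∑-comm (λ t x → w t * ⟦ (J t ∩ X) x ⟧) ⟩
  sum (λ x → sum (λ t → w t * ⟦ (J t ∩ X) x ⟧))
    ≡⟨ sum-cong-≗ (λ x → sum-cong-≗ (λ t → pointwise (w t) (J t x) (X x))) ⟩
  sum (λ x → sum (λ t → ⟦ X x ⟧ * (w t * ⟦ J t x ⟧)))
    ≡⟨ sum-cong-≗ (λ x → *-distribˡ-sum ⟦ X x ⟧ (λ t → w t * ⟦ J t x ⟧)) ⟨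
  sum (λ x → ⟦ X x ⟧ * sum (λ t → w t * ⟦ J t x ⟧)) ∎
  where
  open ≡.≡-Reasoning
  pointwise : ∀ c a b → c * ⟦ a ∧ b ⟧ ≡ ⟦ b ⟧ * (c * ⟦ a ⟧)
  pointwise c a b rewrite ⟦∧⟧ a b = solve 3 (λ c a b → c :* (a :* b) := b :* (c :* a)) refl c ⟦ a ⟧ ⟦ b ⟧

-- Double counting with X = I ∪ N(I): |I| Σ w ≤ Σ_t w_t |J_t ∩ X| = Σ_{x ∈ X} load x ≤ |X| (p/q) Σ w.
tight⇒nbhdRatio≤ : ∀ {p q K W} → 0 < q → Closed K W → Tight p q K W → NbhdRatio≤ p q K W
tight⇒nbhdRatio≤ {p} {q} {K} {W} q>0 cl (bound , cover) I indI I⊆W =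
  *-cancelʳ-≤ _ _ (sum weight) {{>-nonZero weight-positive}} (begin
    card I * q * sum weight
      ≡⟨ solve 3 (λ a q s → a :* q :* s := s :* a :* q) refl (card I) q (sum weight) ⟩
    sum weight * card I * q                         ≡⟨ cong (_* q) (*-distribʳ-sum (card I) weight) ⟩
    sum (λ t → weight t * card I) * q               ≤⟨ *-monoˡ-≤ q (sum-mono-≤ meets) ⟩
    sum (λ t → weight t * card (member t ∩ X)) * q  ≡⟨ cong (_* q) (weighted-card-∩ weight member X) ⟩
    sum (λ x → ⟦ X x ⟧ * load′ x) * q               ≡⟨ *-distribʳ-sum q (λ x → ⟦ X x ⟧ * load′ x) ⟩
    sum (λ x → ⟦ X x ⟧ * load′ x * q)               ≤⟨ sum-mono-≤ loaded ⟩
    sum (λ x → ⟦ X x ⟧ * (p * sum weight))          ≡⟨ *-distribʳ-sum (p * sum weight) (λ x → ⟦ X x ⟧) ⟨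
    card X * (p * sum weight)                       ≡⟨ cong (_* (p * sum weight)) (card-closedNbhd K indI) ⟩
    (card I + card (N′ K I)) * (p * sum weight)
      ≡⟨ solve 3 (λ a p s → a :* (p :* s) := p :* a :* s) refl (card I + card (N′ K I)) p (sum weight) ⟩
    p * (card I + card (N′ K I)) * sum weight ∎)
  where
  open FractionalCover cover
  open ≤-Reasoning
  X = I ∪ N′ K I
  load′ : Fin (size K) → ℕ
  load′ x = sum (λ t → weight t * ⟦ member t x ⟧)
  meets : ∀ t → weight t * card I ≤ weight t * card (member t ∩ X)
  meets t with member-large t
  ... | inj₁ wt≡0 rewrite wt≡0 = z≤n
  ... | inj₂ (indJ , J⊆W , large) =
    *-monoʳ-≤ (weight t) (large-independent-meets-closedNbhd {p} {q} {K} {W} q>0 bound indI I⊆W indJ J⊆W large)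
  loaded : ∀ x → ⟦ X x ⟧ * load′ x * q ≤ ⟦ X x ⟧ * (p * sum weight)
  loaded x with X x in e
  ... | false = z≤n
  ... | true  = ≤-trans (≤-reflexive (cong (_* q) (+-identityʳ (load′ x))))
                (≤-trans (load x (closedNbhd-⊆ K cl I⊆W x e)) (≤-reflexive (≡.sym (+-identityʳ _))))

module _ (K : Graph) {W₁ W₂ : VSet (size K)} (cl₁ : Closed K W₁) (cl₂ : Closed K W₂) (disj : Disjoint W₁ W₂) where

  private
    ∩-split : ∀ {I} → I ⊆ W₁ ∪ W₂ → I ≗ (I ∩ W₁) ∪ (I ∩ W₂)
    ∩-split {I} I⊆W x with I x in e
    ... | false = refl
    ... | true  = ≡.sym (I⊆W x e)

    ∩⊆ʳ : ∀ {n} (I W : VSet n) → I ∩ W ⊆ W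
    ∩⊆ʳ I W x = ∧-conicalʳ (I x) (W x)

    card-split : ∀ {I} → I ⊆ W₁ ∪ W₂ → card I ≡ card (I ∩ W₁) + card (I ∩ W₂)
    card-split {I} I⊆W = ≡.trans (card-cong (∩-split I⊆W)) (card-∪ (Disjoint-⊆ (∩⊆ʳ I W₁) (∩⊆ʳ I W₂) disj))

    card-N′-split : ∀ {I} → I ⊆ W₁ ∪ W₂ → card (N′ K I) ≡ card (N′ K (I ∩ W₁)) + card (N′ K (I ∩ W₂))
    card-N′-split {I} I⊆W = begin
      card (N′ K I)                                ≡⟨ card-cong (N′-cong K (∩-split I⊆W)) ⟩
      card (N′ K ((I ∩ W₁) ∪ (I ∩ W₂)))            ≡⟨ card-cong (N′-∪ K (I ∩ W₁) (I ∩ W₂)) ⟩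
      card (N′ K (I ∩ W₁) ∪ N′ K (I ∩ W₂))
        ≡⟨ card-∪ (Disjoint-⊆ (N′-closed K cl₁ (∩⊆ʳ I W₁)) (N′-closed K cl₂ (∩⊆ʳ I W₂)) disj) ⟩
      card (N′ K (I ∩ W₁)) + card (N′ K (I ∩ W₂))  ∎
      where open ≡.≡-Reasoning

    ∩-independent : ∀ {I} W → Independent′ K I → Independent′ K (I ∩ W)
    ∩-independent {I} W ind u v Iu Iv = ind u v (∧-conicalˡ (I u) (W u) Iu) (∧-conicalˡ (I v) (W v) Iv)

  ∪-nbhdRatio≤ : ∀ {p q} → NbhdRatio≤ p q K W₁ → NbhdRatio≤ p q K W₂ → NbhdRatio≤ p q K (W₁ ∪ W₂)
  ∪-nbhdRatio≤ {p} {q} bound₁ bound₂ I ind I⊆W = begin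
    card I * q                                  ≡⟨ cong (_* q) (card-split I⊆W) ⟩
    (a₁ + a₂) * q                               ≡⟨ *-distribʳ-+ q a₁ a₂ ⟩
    a₁ * q + a₂ * q                             ≤⟨ +-mono-≤ (bound₁ I₁ (∩-independent W₁ ind) (∩⊆ʳ I W₁))
                                                            (bound₂ I₂ (∩-independent W₂ ind) (∩⊆ʳ I W₂)) ⟩
    p * (a₁ + b₁) + p * (a₂ + b₂)
      ≡⟨ solve 5 (λ p a₁ b₁ a₂ b₂ → p :* (a₁ :+ b₁) :+ p :* (a₂ :+ b₂) := p :* ((a₁ :+ a₂) :+ (b₁ :+ b₂)))
               refl p a₁ b₁ a₂ b₂ ⟩
    p * ((a₁ + a₂) + (b₁ + b₂))
      ≡⟨ cong₂ (λ a b → p * (a + b)) (card-split I⊆W) (card-N′-split I⊆W) ⟨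
    p * (card I + card (N′ K I))                ∎
    where
    open ≤-Reasoning
    I₁ = I ∩ W₁
    I₂ = I ∩ W₂
    a₁ = card I₁
    a₂ = card I₂
    b₁ = card (N′ K I₁)
    b₂ = card (N′ K I₂)

  ∪-indepRatio≤ : ∀ {p q} → IndepRatio≤ p q K W₁ → IndepRatio≤ p q K W₂ → IndepRatio≤ p q K (W₁ ∪ W₂)
  ∪-indepRatio≤ {p} {q} bound₁ bound₂ I ind I⊆W = begin
    card I * q                                  ≡⟨ cong (_* q) (card-split I⊆W) ⟩
    (card (I ∩ W₁) + card (I ∩ W₂)) * q         ≡⟨ *-distribʳ-+ q (card (I ∩ W₁)) (card (I ∩ W₂)) ⟩
    card (I ∩ W₁) * q + card (I ∩ W₂) * q
      ≤⟨ +-mono-≤ (bound₁ (I ∩ W₁) (∩-independent W₁ ind) (∩⊆ʳ I W₁))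
                  (bound₂ (I ∩ W₂) (∩-independent W₂ ind) (∩⊆ʳ I W₂)) ⟩
    p * card W₁ + p * card W₂                   ≡⟨ *-distribˡ-+ p (card W₁) (card W₂) ⟨
    p * (card W₁ + card W₂)                     ≡⟨ cong (p *_) (card-∪ disj) ⟨
    p * card (W₁ ∪ W₂)                          ∎
    where open ≤-Reasoning

  ∪-cover : ∀ {p q} → FractionalCover p q K W₁ → FractionalCover p q K W₂ → FractionalCover p q K (W₁ ∪ W₂)
  ∪-cover {p} {q} cover₁ cover₂ = record
    { count           = C₁.count * C₂.count
    ; member          = member
    ; weight          = weight
    ; weight-positive = ≡.subst (0 <_) (≡.sym (sum-pairs C₁.weight C₂.weight))
                                (*-mono-< C₁.weight-positive C₂.weight-positive)
    ; member-large    = member-large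
    ; load            = load
    }
    where
    module C₁ = FractionalCover cover₁
    module C₂ = FractionalCover cover₂
    split : Fin (C₁.count * C₂.count) → Fin C₁.count × Fin C₂.count
    split = remQuot C₂.count
    member : Fin (C₁.count * C₂.count) → VSet (size K)
    member k = let (t , s) = split k in C₁.member t ∪ C₂.member s
    weight : Fin (C₁.count * C₂.count) → ℕ
    weight k = let (t , s) = split k in C₁.weight t * C₂.weight s
    member-large : ∀ k → weight k ≡ 0 ⊎
      (Independent′ K (member k) × member k ⊆ W₁ ∪ W₂ × p * card (W₁ ∪ W₂) ≤ card (member k) * q)
    member-large k = large (proj₁ (split k)) (proj₂ (split k))
      where
      large : ∀ t s → C₁.weight t * C₂.weight s ≡ 0 ⊎
        (Independent′ K (C₁.member t ∪ C₂.member s) × C₁.member t ∪ C₂.member s ⊆ W₁ ∪ W₂ ×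
         p * card (W₁ ∪ W₂) ≤ card (C₁.member t ∪ C₂.member s) * q)
      large t s with C₁.member-large t | C₂.member-large s
      ... | inj₁ w₁≡0 | _         = inj₁ (cong (_* C₂.weight s) w₁≡0)
      ... | inj₂ _    | inj₁ w₂≡0 = inj₁ (≡.trans (cong (C₁.weight t *_) w₂≡0) (*-zeroʳ (C₁.weight t)))
      ... | inj₂ (ind₁ , A⊆W₁ , large₁) | inj₂ (ind₂ , B⊆W₂ , large₂) =
        inj₂ (∪-independent K cl₁ disj A⊆W₁ B⊆W₂ ind₁ ind₂ , ⊆W , (begin
          p * card (W₁ ∪ W₂)                ≡⟨ cong (p *_) (card-∪ disj) ⟩
          p * (card W₁ + card W₂)           ≡⟨ *-distribˡ-+ p (card W₁) (card W₂) ⟩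
          p * card W₁ + p * card W₂         ≤⟨ +-mono-≤ large₁ large₂ ⟩
          card A * q + card B * q           ≡⟨ *-distribʳ-+ q (card A) (card B) ⟨
          (card A + card B) * q             ≡⟨ cong (_* q) (card-∪ (Disjoint-⊆ A⊆W₁ B⊆W₂ disj)) ⟨
          card (A ∪ B) * q                  ∎))
        where
        open ≤-Reasoning
        A = C₁.member t
        B = C₂.member s
        ⊆W : A ∪ B ⊆ W₁ ∪ W₂
        ⊆W x ABx with ∨-elim (A x) _ ABx
        ... | inj₁ Ax = ∨-introˡ _ (A⊆W₁ x Ax)
        ... | inj₂ Bx = ∨-introʳ (W₁ x) (B⊆W₂ x Bx)
    only-left : ∀ f g a b → g * ⟦ b ⟧ ≡ 0 → f * g * ⟦ a ∨ b ⟧ ≡ f * ⟦ a ⟧ * g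
    only-left f g a false _ rewrite ∨-identityʳ a = solve 3 (λ f g a → f :* g :* a := f :* a :* g) refl f g ⟦ a ⟧
    only-left f zero a true _ rewrite *-zeroʳ f = ≡.sym (*-zeroʳ (f * ⟦ a ⟧))
    only-right : ∀ f g a b → f * ⟦ a ⟧ ≡ 0 → f * g * ⟦ a ∨ b ⟧ ≡ f * (g * ⟦ b ⟧)
    only-right f g false b _ = *-assoc f g ⟦ b ⟧
    only-right zero g true b _ = refl
    load : ∀ x → (W₁ ∪ W₂) x ≡ true → sum (λ k → weight k * ⟦ member k x ⟧) * q ≤ p * sum weight
    load x Wx with ∨-elim (W₁ x) _ Wx
    ... | inj₁ W₁x = sum-pairs-≤ˡ C₁.weight C₂.weight (λ t s → ⟦ C₁.member t x ∨ C₂.member s x ⟧) {p} {q}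
      (λ t → ⟦ C₁.member t x ⟧)
      (λ t s → only-left (C₁.weight t) (C₂.weight s) (C₁.member t x) (C₂.member s x) (C₂.vanishes-outside (disj x W₁x) s))
      (C₁.load x W₁x)
    ... | inj₂ W₂x = sum-pairs-≤ʳ C₁.weight C₂.weight (λ t s → ⟦ C₁.member t x ∨ C₂.member s x ⟧) {p} {q}
      (λ s → ⟦ C₂.member s x ⟧)
      (λ t s → only-right (C₁.weight t) (C₂.weight s) (C₁.member t x) (C₂.member s x) (C₁.vanishes-outside W₁x≡false t))
      (C₂.load x W₂x)
      where
      W₁x≡false : W₁ x ≡ false
      W₁x≡false with W₁ x in e
      ... | false = refl
      ... | true  = ⊥-elim (true≢false (≡.trans (≡.sym W₂x) (disj x e)))

  ∪-tight : ∀ {p q} → Tight p q K W₁ → Tight p q K W₂ → Tight p q K (W₁ ∪ W₂)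
  ∪-tight {p} {q} (bound₁ , cover₁) (bound₂ , cover₂) =
    ∪-indepRatio≤ {p} {q} bound₁ bound₂ , ∪-cover {p} {q} cover₁ cover₂

tight-scale : ∀ {p q K W} c → Tight p q K W → Tight (p * c) (q * c) K W
tight-scale {p} {q} {K} {W} c (bound , cover) = bound′ , record
  { count = count ; member = member ; weight = weight ; weight-positive = weight-positive
  ; member-large = member-large′
  ; load = λ x Wx → scaled {sum (λ t → weight t * ⟦ member t x ⟧)} {q} {p} {sum weight} (load x Wx) }
  where
  open FractionalCover cover
  scaled : ∀ {a b d e} → a * b ≤ d * e → a * (b * c) ≤ d * c * e
  scaled {a} {b} {d} {e} ab≤de = begin
    a * (b * c) ≡⟨ *-assoc a b c ⟨
    a * b * c   ≤⟨ *-monoˡ-≤ c ab≤de ⟩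
    d * e * c   ≡⟨ solve 3 (λ d e c → d :* e :* c := d :* c :* e) refl d e c ⟩
    d * c * e   ∎
    where open ≤-Reasoning
  bound′ : IndepRatio≤ (p * c) (q * c) K W
  bound′ I ind I⊆W = scaled {card I} {q} {p} {card W} (bound I ind I⊆W)
  member-large′ : ∀ t → weight t ≡ 0 ⊎
    (Independent′ K (member t) × member t ⊆ W × p * c * card W ≤ card (member t) * (q * c))
  member-large′ t with member-large t
  ... | inj₁ wt≡0 = inj₁ wt≡0
  ... | inj₂ (ind , J⊆W , large) = inj₂ (ind , J⊆W , (begin
    p * c * card W             ≡⟨ solve 3 (λ p c w → p :* c :* w := p :* w :* c) refl p c (card W) ⟩
    p * card W * c             ≤⟨ *-monoˡ-≤ c large ⟩
    card (member t) * q * c    ≡⟨ *-assoc (card (member t)) q c ⟩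
    card (member t) * (q * c)  ∎))
    where open ≤-Reasoning

tight-∅ : ∀ {p q} K → Tight p q K ∅
tight-∅ {p} {q} K =
  (λ I _ I⊆∅ → ≤-trans (≤-reflexive (cong (_* q) (⊆∅⇒card≡0 I⊆∅))) z≤n) ,
  record { count = 1 ; member = λ _ → ∅ ; weight = λ _ → 1 ; weight-positive = s≤s z≤n
         ; member-large = λ _ → inj₂ ((λ _ _ ()) , (λ _ e → e) , ≤-reflexive p∅≡∅q) ; load = λ _ () }
  where
  ⊆∅⇒card≡0 : ∀ {I} → I ⊆ ∅ → card I ≡ 0
  ⊆∅⇒card≡0 I⊆∅ = n≤0⇒n≡0 (≤-trans (card-mono I⊆∅) (≤-reflexive (card-∅ {size K})))
  p∅≡∅q : p * card (∅ {size K}) ≡ card (∅ {size K}) * q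
  p∅≡∅q rewrite card-∅ {size K} = *-zeroʳ p

-- Tensor products

infixr 7 _⊗_
_⊗_ : ∀ {k l} → VSet k → VSet l → VSet (k * l)
(P ⊗ Q) z = let (x , y) = remQuot _ z in P x ∧ Q y

⊗-combine : ∀ {k l} (P : VSet k) (Q : VSet l) x y → (P ⊗ Q) (combine x y) ≡ P x ∧ Q y
⊗-combine {k} {l} P Q x y = cong (λ (x , y) → P x ∧ Q y) (remQuot-combine {k} {l} x y)

sum₂-⟦∧⟧ : ∀ {k l} (P : VSet k) (Q : VSet l) → sum (λ x → sum (λ y → ⟦ P x ∧ Q y ⟧)) ≡ card P * card Q
sum₂-⟦∧⟧ P Q =
  ≡.trans (sum-cong-≗ λ x → sum-cong-≗ λ y → ⟦∧⟧ (P x) (Q y)) (sum-*-sum (λ x → ⟦ P x ⟧) (λ y → ⟦ Q y ⟧))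

card-⊗ : ∀ {k l} (P : VSet k) (Q : VSet l) → card (P ⊗ Q) ≡ card P * card Q
card-⊗ {k} {l} P Q = ≡.trans (sum-remQuot {k} {l} (λ x y → ⟦ P x ∧ Q y ⟧)) (sum₂-⟦∧⟧ P Q)

adj-combine : ∀ K L x y x′ y′ → adj (tensor K L) (combine x y) (combine x′ y′) ≡ adj K x x′ ∧ adj L y y′
adj-combine K L x y x′ y′ = cong₂ (λ (x , y) (x′ , y′) → adj K x x′ ∧ adj L y y′)
  (remQuot-combine {size K} {size L} x y) (remQuot-combine {size K} {size L} x′ y′)

Closed-⊗ : ∀ K L {W W′} → Closed K W → Closed L W′ → Closed (tensor K L) (W ⊗ W′)
Closed-⊗ K L {W} {W′} cl cl′ z z′ Wz zz′ =
  ∧-intro (cl _ _ (∧-conicalˡ _ _ Wz) (∧-conicalˡ _ _ zz′)) (cl′ _ _ (∧-conicalʳ _ _ Wz) (∧-conicalʳ _ _ zz′))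

⊗-mono : ∀ {k l} {P P′ : VSet k} {Q Q′ : VSet l} → P ⊆ P′ → Q ⊆ Q′ → P ⊗ Q ⊆ P′ ⊗ Q′
⊗-mono P⊆P′ Q⊆Q′ z PQz = ∧-intro (P⊆P′ _ (∧-conicalˡ _ _ PQz)) (Q⊆Q′ _ (∧-conicalʳ _ _ PQz))

⊗-independentˡ : ∀ K L {J} (Q : VSet (size L)) → Independent′ K J → Independent′ (tensor K L) (J ⊗ Q)
⊗-independentˡ K L Q ind z z′ Jz Jz′ = cong (_∧ _) (ind _ _ (∧-conicalˡ _ _ Jz) (∧-conicalˡ _ _ Jz′))

⊗-independentʳ : ∀ K L (P : VSet (size K)) {J} → Independent′ L J → Independent′ (tensor K L) (P ⊗ J)
⊗-independentʳ K L P ind z z′ Jz Jz′ =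
  ≡.trans (cong (adj K _ _ ∧_) (ind _ _ (∧-conicalʳ _ _ Jz) (∧-conicalʳ _ _ Jz′))) (∧-zeroʳ _)

-- Because s/(s + b) ≤ a/(a + b) ≤ p/q and s + b ≤ N.
ratio≤-shrink : ∀ {s a b p q N} → s ≤ a → s + b ≤ N → a * q ≤ p * (a + b) → s * q ≤ p * N
ratio≤-shrink {s} {a} {b} {p} {q} {N} s≤a s+b≤N aq≤p[a+b] with ≤-total q p
... | inj₁ q≤p = begin
  s * q       ≤⟨ *-monoʳ-≤ s q≤p ⟩
  s * p       ≡⟨ *-comm s p ⟩
  p * s       ≤⟨ *-monoʳ-≤ p (≤-trans (m≤m+n s b) s+b≤N) ⟩
  p * N       ∎
  where open ≤-Reasoning
... | inj₂ p≤q = begin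
  s * q            ≡⟨ cong (s *_) (m+[n∸m]≡n p≤q) ⟨
  s * (p + d)      ≡⟨ *-distribˡ-+ s p d ⟩
  s * p + s * d    ≤⟨ +-monoʳ-≤ (s * p) (≤-trans (*-monoˡ-≤ d s≤a) ad≤pb) ⟩
  s * p + p * b    ≡⟨ solve 3 (λ s p b → s :* p :+ p :* b := p :* (s :+ b)) refl s p b ⟩
  p * (s + b)      ≤⟨ *-monoʳ-≤ p s+b≤N ⟩
  p * N            ∎
  where
  open ≤-Reasoning
  d = q ∸ p
  ad≤pb : a * d ≤ p * b
  ad≤pb = +-cancelˡ-≤ (a * p) _ _ (begin
    a * p + a * d    ≡⟨ *-distribˡ-+ a p d ⟨
    a * (p + d)      ≡⟨ cong (a *_) (m+[n∸m]≡n p≤q) ⟩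
    a * q            ≤⟨ aq≤p[a+b] ⟩
    p * (a + b)      ≡⟨ solve 3 (λ p a b → p :* (a :+ b) := a :* p :+ p :* b) refl p a b ⟩
    a * p + p * b    ∎)

⟦⟧-≤-∖+∖ : ∀ a b c → (a ≡ true → b ≡ true → c ≡ true → ⊥) →
           ⟦ a ⟧ ≤ ⟦ a ∧ not b ⟧ + ⟦ a ∧ not c ⟧
⟦⟧-≤-∖+∖ false b     c     _ = z≤n
⟦⟧-≤-∖+∖ true  false c     _ = s≤s z≤n
⟦⟧-≤-∖+∖ true  true  false _ = s≤s z≤n
⟦⟧-≤-∖+∖ true  true  true  h = ⊥-elim (h refl refl refl)

⟦⟧-disjoint₃-≤ : ∀ a b c d → (a ≡ true → d ≡ true) → (b ≡ true → d ≡ true) → (c ≡ true → d ≡ true) →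
                 (a ≡ true → b ≡ true → ⊥) → (a ≡ true → c ≡ true → ⊥) → (b ≡ true → c ≡ true → ⊥) →
                 ⟦ a ⟧ + ⟦ b ⟧ + ⟦ c ⟧ ≤ ⟦ d ⟧
⟦⟧-disjoint₃-≤ true  true  _     _ _  _  _  ab _  _  = ⊥-elim (ab refl refl)
⟦⟧-disjoint₃-≤ true  false true  _ _  _  _  _  ac _  = ⊥-elim (ac refl refl)
⟦⟧-disjoint₃-≤ false true  true  _ _  _  _  _  _  bc = ⊥-elim (bc refl refl)
⟦⟧-disjoint₃-≤ true  false false d ad _  _  _  _  _  rewrite ad refl = ≤-refl
⟦⟧-disjoint₃-≤ false true  false d _  bd _  _  _  _  rewrite bd refl = ≤-refl
⟦⟧-disjoint₃-≤ false false true  d _  _  cd _  _  _  rewrite cd refl = ≤-refl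
⟦⟧-disjoint₃-≤ false false false d _  _  _  _  _  _  = z≤n

∖N′-isolated : ∀ K A {u v} → (A ∖ N′ K A) u ≡ true → A v ≡ true → adj K v u ≡ true → ⊥
∖N′-isolated K A {u} {v} A∖Nu Av vu =
  true≢false (≡.trans (≡.sym (N′-intro K A v u Av vu)) (proj₂ (∖-elim (A u) _ A∖Nu)))

∖N′-independent : ∀ K A → Independent′ K (A ∖ N′ K A)
∖N′-independent K A u v A∖Nu A∖Nv with adj K u v in e
... | false = refl
... | true  = ⊥-elim (∖N′-isolated K A A∖Nv (proj₁ (∖-elim (A u) _ A∖Nu)) e)

-- An independent set S of K × L inside W ⊗ W′ is cut into columns and rows; each column (row)
-- minus its own neighbourhood is independent, these pieces still cover S, and S together with
-- the neighbourhoods of the pieces is a disjoint family inside W ⊗ W′.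
module Slices (K L : Graph) {W W′} (cl : Closed K W) (cl′ : Closed L W′)
  {S : VSet (size K * size L)} (indS : Independent′ (tensor K L) S) (S⊆W⊗W′ : S ⊆ W ⊗ W′) where

  s : Fin (size K) → Fin (size L) → Bool
  s x y = S (combine x y)

  column : Fin (size L) → VSet (size K)
  column y x = s x y

  column′ : Fin (size L) → VSet (size K)
  column′ y = column y ∖ N′ K (column y)

  row′ : Fin (size K) → VSet (size L)
  row′ x = s x ∖ N′ L (s x)

  no-cross : ∀ {x y x′ y′} → s x y ≡ true → s x′ y′ ≡ true → adj K x x′ ≡ true → adj L y y′ ≡ true → ⊥
  no-cross {x} {y} {x′} {y′} sxy sx′y′ xx′ yy′ = true≢false (begin
    true                                       ≡⟨ ∧-intro xx′ yy′ ⟨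
    adj K x x′ ∧ adj L y y′                    ≡⟨ adj-combine K L x y x′ y′ ⟨
    adj (tensor K L) (combine x y) (combine x′ y′) ≡⟨ indS _ _ sxy sx′y′ ⟩
    false                                      ∎)
    where open ≡.≡-Reasoning

  s⊆ : ∀ {x y} → s x y ≡ true → W x ≡ true × W′ y ≡ true
  s⊆ {x} {y} sxy = let WW′ = ≡.trans (≡.sym (⊗-combine W W′ x y)) (S⊆W⊗W′ _ sxy) in
                   ∧-conicalˡ _ _ WW′ , ∧-conicalʳ _ _ WW′

  column′⊆ : ∀ y → column′ y ⊆ W
  column′⊆ y x e = proj₁ (s⊆ (proj₁ (∖-elim (s x y) _ e)))

  row′⊆ : ∀ x → row′ x ⊆ W′
  row′⊆ x y e = proj₂ (s⊆ (proj₁ (∖-elim (s x y) _ e)))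

  Σcolumn′ Σrow′ ΣN-column′ ΣN-row′ : ℕ
  Σcolumn′   = sum (λ y → card (column′ y))
  Σrow′      = sum (λ x → card (row′ x))
  ΣN-column′ = sum (λ y → card (N′ K (column′ y)))
  ΣN-row′    = sum (λ x → card (N′ L (row′ x)))

  private
    Σ₂ : (Fin (size K) → Fin (size L) → ℕ) → ℕ
    Σ₂ f = sum (λ x → sum (f x))

    ⟦s⟧ ⟦N-column′⟧ ⟦N-row′⟧ : Fin (size K) → Fin (size L) → ℕ
    ⟦s⟧ x y         = ⟦ s x y ⟧
    ⟦N-column′⟧ x y = ⟦ N′ K (column′ y) x ⟧
    ⟦N-row′⟧ x y    = ⟦ N′ L (row′ x) y ⟧

  covered : card S ≤ Σcolumn′ + Σrow′
  covered = begin
    card S                                           ≡⟨ sum-combine {size K} {size L} _ ⟩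
    Σ₂ ⟦s⟧
      ≤⟨ sum-mono-≤ (λ x → sum-mono-≤ (λ y → ⟦⟧-≤-∖+∖ _ _ _ (uncovered x y))) ⟩
    Σ₂ (λ x y → ⟦ column′ y x ⟧ + ⟦ row′ x y ⟧)
      ≡⟨ sum₂-distrib-+ (λ x y → ⟦ column′ y x ⟧) (λ x y → ⟦ row′ x y ⟧) ⟩
    Σ₂ (λ x y → ⟦ column′ y x ⟧) + Σrow′
      ≡⟨ cong (_+ Σrow′) (∑-comm (λ x y → ⟦ column′ y x ⟧)) ⟩
    Σcolumn′ + Σrow′                                 ∎
    where
    open ≤-Reasoning
    uncovered : ∀ x y → s x y ≡ true → N′ K (column y) x ≡ true → N′ L (s x) y ≡ true → ⊥
    uncovered x y _ Nx Ny with N′-elim K (column y) x Nx | N′-elim L (s x) y Ny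
    ... | x′ , sx′y , x′x | y′ , sxy′ , y′y = no-cross sx′y sxy′ x′x (≡.trans (Graph.sym L y y′) y′y)

  packed : card S + (ΣN-column′ + ΣN-row′) ≤ card W * card W′
  packed = begin
    card S + (ΣN-column′ + ΣN-row′)
      ≡⟨ cong₂ (λ a b → a + (b + ΣN-row′)) (sum-combine {size K} {size L} _) (∑-comm (λ y x → ⟦N-column′⟧ x y)) ⟩
    Σ₂ ⟦s⟧ + (Σ₂ ⟦N-column′⟧ + ΣN-row′)
      ≡⟨ +-assoc (Σ₂ ⟦s⟧) (Σ₂ ⟦N-column′⟧) ΣN-row′ ⟨
    Σ₂ ⟦s⟧ + Σ₂ ⟦N-column′⟧ + ΣN-row′
      ≡⟨ cong (_+ ΣN-row′) (sum₂-distrib-+ ⟦s⟧ ⟦N-column′⟧) ⟨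
    Σ₂ (λ x y → ⟦s⟧ x y + ⟦N-column′⟧ x y) + ΣN-row′
      ≡⟨ sum₂-distrib-+ (λ x y → ⟦s⟧ x y + ⟦N-column′⟧ x y) ⟦N-row′⟧ ⟨
    Σ₂ (λ x y → ⟦s⟧ x y + ⟦N-column′⟧ x y + ⟦N-row′⟧ x y)
      ≤⟨ sum-mono-≤ (λ x → sum-mono-≤ (λ y → disjoint-inside x y)) ⟩
    Σ₂ (λ x y → ⟦ W x ∧ W′ y ⟧)
      ≡⟨ sum₂-⟦∧⟧ W W′ ⟩
    card W * card W′ ∎
    where
    open ≤-Reasoning
    disjoint-inside : ∀ x y → ⟦ s x y ⟧ + ⟦ N′ K (column′ y) x ⟧ + ⟦ N′ L (row′ x) y ⟧ ≤ ⟦ W x ∧ W′ y ⟧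
    disjoint-inside x y = ⟦⟧-disjoint₃-≤ _ _ _ _ S-in N-column-in N-row-in S-N-column S-N-row N-column-N-row
      where
      S-in : s x y ≡ true → W x ∧ W′ y ≡ true
      S-in sxy = ∧-intro (proj₁ (s⊆ sxy)) (proj₂ (s⊆ sxy))
      N-column-in : N′ K (column′ y) x ≡ true → W x ∧ W′ y ≡ true
      N-column-in e with N′-elim K (column′ y) x e
      ... | x′ , c′x′ , x′x = let sx′y = proj₁ (∖-elim (s x′ y) _ c′x′) in
                             ∧-intro (cl x′ x (proj₁ (s⊆ sx′y)) x′x) (proj₂ (s⊆ sx′y))
      N-row-in : N′ L (row′ x) y ≡ true → W x ∧ W′ y ≡ true
      N-row-in e with N′-elim L (row′ x) y e
      ... | y′ , r′y′ , y′y = let sxy′ = proj₁ (∖-elim (s x y′) _ r′y′) in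
                             ∧-intro (proj₁ (s⊆ sxy′)) (cl′ y′ y (proj₂ (s⊆ sxy′)) y′y)
      S-N-column : s x y ≡ true → N′ K (column′ y) x ≡ true → ⊥
      S-N-column sxy e with N′-elim K (column′ y) x e
      ... | x′ , c′x′ , x′x = ∖N′-isolated K (column y) c′x′ sxy (≡.trans (Graph.sym K x x′) x′x)
      S-N-row : s x y ≡ true → N′ L (row′ x) y ≡ true → ⊥
      S-N-row sxy e with N′-elim L (row′ x) y e
      ... | y′ , r′y′ , y′y = ∖N′-isolated L (s x) r′y′ sxy (≡.trans (Graph.sym L y y′) y′y)
      N-column-N-row : N′ K (column′ y) x ≡ true → N′ L (row′ x) y ≡ true → ⊥
      N-column-N-row e e′ with N′-elim K (column′ y) x e | N′-elim L (row′ x) y e′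
      ... | x′ , c′x′ , x′x | y′ , r′y′ , y′y =
        no-cross (proj₁ (∖-elim (s x′ y) _ c′x′)) (proj₁ (∖-elim (s x y′) _ r′y′))
                 x′x (≡.trans (Graph.sym L y y′) y′y)

tensor-indepRatio≤ : ∀ {p q K L W W′} → Closed K W → Closed L W′ →
                     NbhdRatio≤ p q K W → NbhdRatio≤ p q L W′ → IndepRatio≤ p q (tensor K L) (W ⊗ W′)
tensor-indepRatio≤ {p} {q} {K} {L} {W} {W′} cl cl′ boundK boundL S indS S⊆ =
  ≤-trans (ratio≤-shrink {p = p} {q} covered packed (begin
    (Σcolumn′ + Σrow′) * q                            ≡⟨ *-distribʳ-+ q Σcolumn′ Σrow′ ⟩
    Σcolumn′ * q + Σrow′ * q
      ≤⟨ +-mono-≤ (summed (λ y → boundK (column′ y) (∖N′-independent K _) (column′⊆ y)))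
                  (summed (λ x → boundL (row′ x) (∖N′-independent L _) (row′⊆ x))) ⟩
    p * (Σcolumn′ + ΣN-column′) + p * (Σrow′ + ΣN-row′)
      ≡⟨ solve 5 (λ p a b c d → p :* (a :+ b) :+ p :* (c :+ d) := p :* ((a :+ c) :+ (b :+ d)))
               refl p Σcolumn′ ΣN-column′ Σrow′ ΣN-row′ ⟩
    p * ((Σcolumn′ + Σrow′) + (ΣN-column′ + ΣN-row′))  ∎))
  (≤-reflexive (cong (p *_) (≡.sym (card-⊗ W W′))))
  where
  open Slices K L cl cl′ indS S⊆
  open ≤-Reasoning
  summed : ∀ {m} {a b : Fin m → ℕ} → (∀ i → a i * q ≤ p * (a i + b i)) → sum a * q ≤ p * (sum a + sum b)
  summed {a = a} {b} h = begin
    sum a * q                       ≡⟨ *-distribʳ-sum q a ⟩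
    sum (λ i → a i * q)             ≤⟨ sum-mono-≤ h ⟩
    sum (λ i → p * (a i + b i))     ≡⟨ *-distribˡ-sum p (λ i → a i + b i) ⟨
    p * sum (λ i → a i + b i)       ≡⟨ cong (p *_) (∑-distrib-+ a b) ⟩
    p * (sum a + sum b)             ∎

⊗-coverˡ : ∀ {p q K} L {W W′} → FractionalCover p q K W → FractionalCover p q (tensor K L) (W ⊗ W′)
⊗-coverˡ {p} {q} {K} L {W} {W′} cover = record
  { count = count ; member = λ t → member t ⊗ W′ ; weight = weight ; weight-positive = weight-positive
  ; member-large = member-large′ ; load = load′ }
  where
  open FractionalCover cover
  member-large′ : ∀ t → weight t ≡ 0 ⊎ (Independent′ (tensor K L) (member t ⊗ W′) ×
                  member t ⊗ W′ ⊆ W ⊗ W′ × p * card (W ⊗ W′) ≤ card (member t ⊗ W′) * q)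
  member-large′ t with member-large t
  ... | inj₁ wt≡0 = inj₁ wt≡0
  ... | inj₂ (ind , J⊆W , large) =
    inj₂ (⊗-independentˡ K L W′ ind , ⊗-mono {P = member t} {W} {W′} {W′} J⊆W (λ _ e → e) , (begin
    p * card (W ⊗ W′)              ≡⟨ cong (p *_) (card-⊗ W W′) ⟩
    p * (card W * card W′)         ≡⟨ *-assoc p (card W) (card W′) ⟨
    p * card W * card W′           ≤⟨ *-monoˡ-≤ (card W′) large ⟩
    card (member t) * q * card W′  ≡⟨ solve 3 (λ j q w → j :* q :* w := j :* w :* q) refl (card (member t)) q (card W′) ⟩
    card (member t) * card W′ * q  ≡⟨ cong (_* q) (card-⊗ (member t) W′) ⟨
    card (member t ⊗ W′) * q       ∎))
    where open ≤-Reasoning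
  load′ : ∀ z → (W ⊗ W′) z ≡ true → sum (λ t → weight t * ⟦ (member t ⊗ W′) z ⟧) * q ≤ p * sum weight
  load′ z WW′z = ≤-trans (≤-reflexive (cong (_* q) (sum-cong-≗ λ t → cong (λ b → weight t * ⟦ b ⟧)
                   (≡.trans (cong (member t _ ∧_) (∧-conicalʳ _ _ WW′z)) (∧-identityʳ _)))))
                 (load _ (∧-conicalˡ _ _ WW′z))

⊗-coverʳ : ∀ {p q} K {L W W′} → FractionalCover p q L W′ → FractionalCover p q (tensor K L) (W ⊗ W′)
⊗-coverʳ {p} {q} K {L} {W} {W′} cover = record
  { count = count ; member = λ t → W ⊗ member t ; weight = weight ; weight-positive = weight-positive
  ; member-large = member-large′ ; load = load′ }
  where
  open FractionalCover cover
  member-large′ : ∀ t → weight t ≡ 0 ⊎ (Independent′ (tensor K L) (W ⊗ member t) ×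
                  W ⊗ member t ⊆ W ⊗ W′ × p * card (W ⊗ W′) ≤ card (W ⊗ member t) * q)
  member-large′ t with member-large t
  ... | inj₁ wt≡0 = inj₁ wt≡0
  ... | inj₂ (ind , J⊆W′ , large) =
    inj₂ (⊗-independentʳ K L W ind , ⊗-mono {P = W} {W} {member t} {W′} (λ _ e → e) J⊆W′ , (begin
    p * card (W ⊗ W′)              ≡⟨ cong (p *_) (card-⊗ W W′) ⟩
    p * (card W * card W′)         ≡⟨ solve 3 (λ p w w′ → p :* (w :* w′) := w :* (p :* w′)) refl p (card W) (card W′) ⟩
    card W * (p * card W′)         ≤⟨ *-monoʳ-≤ (card W) large ⟩
    card W * (card (member t) * q) ≡⟨ *-assoc (card W) (card (member t)) q ⟨
    card W * card (member t) * q   ≡⟨ cong (_* q) (card-⊗ W (member t)) ⟨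
    card (W ⊗ member t) * q        ∎))
    where open ≤-Reasoning
  load′ : ∀ z → (W ⊗ W′) z ≡ true → sum (λ t → weight t * ⟦ (W ⊗ member t) z ⟧) * q ≤ p * sum weight
  load′ z WW′z = ≤-trans (≤-reflexive (cong (_* q) (sum-cong-≗ λ t → cong (λ b → weight t * ⟦ b ⟧)
                   (≡.trans (cong (_∧ member t _) (∧-conicalˡ _ _ WW′z)) (∧-identityˡ _)))))
                 (load _ (∧-conicalʳ _ _ WW′z))

tensor-tightˡ : ∀ {p q K L W W′} → 0 < q → Closed K W → Closed L W′ →
                Tight p q K W → NbhdRatio≤ p q L W′ → Tight p q (tensor K L) (W ⊗ W′)
tensor-tightˡ {p} {q} {K} {L} {W} {W′} q>0 cl cl′ tight boundL =
  tensor-indepRatio≤ {p} {q} {K} {L} {W} {W′} cl cl′ (tight⇒nbhdRatio≤ {p} {q} {K} {W} q>0 cl tight) boundL ,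
  ⊗-coverˡ L {W} {W′} (proj₂ tight)

tensor-tightʳ : ∀ {p q K L W W′} → 0 < q → Closed K W → Closed L W′ →
                NbhdRatio≤ p q K W → Tight p q L W′ → Tight p q (tensor K L) (W ⊗ W′)
tensor-tightʳ {p} {q} {K} {L} {W} {W′} q>0 cl cl′ boundK tight =
  tensor-indepRatio≤ {p} {q} {K} {L} {W} {W′} cl cl′ boundK (tight⇒nbhdRatio≤ {p} {q} {L} {W′} q>0 cl′ tight) ,
  ⊗-coverʳ K {L} {W} {W′} (proj₂ tight)

-- Vertex-transitive graphs

funToFin-cong : ∀ {m n} {f g : Fin m → Fin n} → f ≗ g → funToFin f ≡ funToFin g
funToFin-cong {zero}  _   = refl
funToFin-cong {suc m} f≗g = cong₂ combine (f≗g zero) (funToFin-cong (f≗g ∘ suc))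

subsetAt : ∀ {n} → Fin (2 ^ n) → VSet n
subsetAt t = Inverse.to 2↔Bool ∘ finToFun t

indexOf : ∀ {n} → VSet n → Fin (2 ^ n)
indexOf P = funToFin (Inverse.from 2↔Bool ∘ P)

indexOf-cong : ∀ {n} {P Q : VSet n} → P ≗ Q → indexOf P ≡ indexOf Q
indexOf-cong P≗Q = funToFin-cong (cong (Inverse.from 2↔Bool) ∘ P≗Q)

subsetAt-indexOf : ∀ {n} (P : VSet n) → subsetAt (indexOf P) ≗ P
subsetAt-indexOf P x = ≡.trans (cong (Inverse.to 2↔Bool) (finToFun-funToFin (Inverse.from 2↔Bool ∘ P) x))
                                (Inverse.strictlyInverseˡ 2↔Bool (P x))

indexOf-subsetAt : ∀ {n} (t : Fin (2 ^ n)) → indexOf (subsetAt {n} t) ≡ t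
indexOf-subsetAt {n} t = ≡.trans (funToFin-cong {n} (Inverse.strictlyInverseʳ 2↔Bool ∘ finToFun t))
                                  (funToFin-finToFin {n} t)

independent? : ∀ K I → Dec (Independent′ K I)
independent? K I = all? λ u → all? λ v →
  (I u Bool.≟ true) →-dec (I v Bool.≟ true) →-dec (adj K u v Bool.≟ false)

maximum-independent : ∀ K → ∃ λ J → Independent′ K J × (∀ I → Independent′ K I → card I ≤ card J)
maximum-independent K = D best , best-independent , best-maximum
  where
  D : Fin (2 ^ size K) → VSet (size K)
  D = subsetAt
  independentAt? : Decidable (Independent′ K ∘ D)
  independentAt? t = independent? K (D t)
  candidates : List (Fin (2 ^ size K))
  candidates = filter independentAt? (allFin _)
  best : Fin (2 ^ size K)
  best = argmax (card ∘ D) (indexOf {size K} ∅) candidates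
  best-independent : Independent′ K (D best)
  best-independent = argmax-all (card ∘ D) {P = Independent′ K ∘ D}
    (Independent′-cong K (≡.sym ∘ subsetAt-indexOf ∅) (λ _ _ ())) (all-filter independentAt? (allFin _))
  best-maximum : ∀ I → Independent′ K I → card I ≤ card (D best)
  best-maximum I ind = ≤-trans (≤-reflexive (card-cong {size K} (≡.sym ∘ subsetAt-indexOf I)))
    (All.lookup (f[xs]≤f[argmax] {f = card ∘ D} (indexOf {size K} ∅) candidates)
      (∈-filter⁺ independentAt? (∈-allFin (indexOf I)) (Independent′-cong K (≡.sym ∘ subsetAt-indexOf I) ind)))

IsAutomorphism : (K : Graph) → Permutation′ (size K) → Set
IsAutomorphism K σ = ∀ x y → adj K (σ ⟨$⟩ʳ x) (σ ⟨$⟩ʳ y) ≡ adj K x y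

image : ∀ {n} → Permutation′ n → VSet n → VSet n
image σ P x = P (σ ⟨$⟩ˡ x)

card-image : ∀ {n} (σ : Permutation′ n) P → card (image σ P) ≡ card P
card-image σ P = ≡.sym (sum-permute (λ x → ⟦ P x ⟧) (flip σ))

image-independent : ∀ K {σ} → IsAutomorphism K σ → ∀ {P} → Independent′ K P → Independent′ K (image σ P)
image-independent K {σ} auto ind u v Pu Pv = begin
  adj K u v                                     ≡⟨ cong₂ (adj K) (inverseʳ σ) (inverseʳ σ) ⟨
  adj K (σ ⟨$⟩ʳ (σ ⟨$⟩ˡ u)) (σ ⟨$⟩ʳ (σ ⟨$⟩ˡ v))   ≡⟨ auto _ _ ⟩
  adj K (σ ⟨$⟩ˡ u) (σ ⟨$⟩ˡ v)                     ≡⟨ ind _ _ Pu Pv ⟩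
  false                                         ∎
  where open ≡.≡-Reasoning

image-independent⁻ : ∀ K {σ} → IsAutomorphism K σ → ∀ {P} → Independent′ K (image σ P) → Independent′ K P
image-independent⁻ K {σ} auto {P} ind u v Pu Pv =
  ≡.trans (≡.sym (auto u v)) (ind _ _ (≡.trans (cong P (inverseˡ σ)) Pu) (≡.trans (cong P (inverseˡ σ)) Pv))

imageAt : ∀ {n} → Permutation′ n → Permutation′ (2 ^ n)
imageAt {n} σ = permutation (act σ) (act (flip σ)) (cancel (flip σ) (inverseʳ σ)) (cancel σ (inverseˡ σ))
  where
  act : Permutation′ n → Fin (2 ^ n) → Fin (2 ^ n)
  act π t = indexOf (image π (subsetAt t))
  cancel : ∀ π → (∀ {x} → π ⟨$⟩ˡ (π ⟨$⟩ʳ x) ≡ x) → ∀ t → act (flip π) (act π t) ≡ t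
  cancel π inv t = ≡.trans (indexOf-cong {n} λ x → ≡.trans (subsetAt-indexOf (image π (subsetAt t)) _) (cong (subsetAt t) inv))
                           (indexOf-subsetAt {n} t)

subsetAt-imageAt : ∀ {n} (σ : Permutation′ n) t → subsetAt (imageAt σ ⟨$⟩ʳ t) ≗ image σ (subsetAt t)
subsetAt-imageAt σ t = subsetAt-indexOf (image σ (subsetAt t))

does-true : ∀ {P : Set} (P? : Dec P) → does P? ≡ true → P
does-true (yes p) _ = p

⟦does⟧-cases : ∀ {P : Set} (P? : Dec P) → ⟦ does P? ⟧ ≡ 0 ⊎ P
⟦does⟧-cases (yes p) = inj₂ p
⟦does⟧-cases (no _)  = inj₁ refl

-- Weighting all maximum independent sets equally covers every vertex equally often, because the
-- automorphisms act transitively on vertices and permute the maximum independent sets.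
module _ (G : Graph) (vt : VertexTransitive G) {J} (indJ : Independent′ G J)
         (maxJ : ∀ I → Independent′ G I → card I ≤ card J) where

  private
    n = size G
    α = card J

    D : Fin (2 ^ n) → VSet n
    D = subsetAt

    IsMaximumAt : Fin (2 ^ n) → Set
    IsMaximumAt t = Independent′ G (D t) × card (D t) ≡ α

    maximumAt? : Decidable IsMaximumAt
    maximumAt? t = independent? G (D t) ×-dec (card (D t) ≟ α)

    weight : Fin (2 ^ n) → ℕ
    weight t = ⟦ does (maximumAt? t) ⟧

    load : Fin n → ℕ
    load x = sum (λ t → weight t * ⟦ D t x ⟧)

    weight-imageAt : ∀ {σ} → IsAutomorphism G σ → ∀ t → weight (imageAt σ ⟨$⟩ʳ t) ≡ weight t
    weight-imageAt {σ} auto t = cong ⟦_⟧ (does-⇔ (mk⇔ to from) (maximumAt? _) (maximumAt? t))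
      where
      D≗ = subsetAt-imageAt σ t
      to : IsMaximumAt (imageAt σ ⟨$⟩ʳ t) → IsMaximumAt t
      to (ind , c) = image-independent⁻ G {σ} auto {D t} (Independent′-cong G D≗ ind) ,
                     ≡.trans (≡.sym (card-image σ (D t))) (≡.trans (≡.sym (card-cong D≗)) c)
      from : IsMaximumAt t → IsMaximumAt (imageAt σ ⟨$⟩ʳ t)
      from (ind , c) = Independent′-cong G (≡.sym ∘ D≗) (image-independent G {σ} auto {D t} ind) ,
                       ≡.trans (card-cong D≗) (≡.trans (card-image σ (D t)) c)

    load-invariant : ∀ x y → load y ≡ load x
    load-invariant x y with vt x y
    ... | σ , auto , σx≡y = begin
      load y
        ≡⟨ sum-permute (λ t → weight t * ⟦ D t y ⟧) (imageAt σ) ⟩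
      sum (λ t → weight (imageAt σ ⟨$⟩ʳ t) * ⟦ D (imageAt σ ⟨$⟩ʳ t) y ⟧)
        ≡⟨ sum-cong-≗ (λ t → cong₂ (λ w b → w * ⟦ b ⟧) (weight-imageAt {σ} auto t)
                                   (≡.trans (subsetAt-imageAt σ t y) (cong (D t) σ⁻¹y≡x))) ⟩
      load x ∎
      where
      open ≡.≡-Reasoning
      σ⁻¹y≡x : σ ⟨$⟩ˡ y ≡ x
      σ⁻¹y≡x = ≡.trans (cong (σ ⟨$⟩ˡ_) (≡.sym σx≡y)) (inverseˡ σ)

    total-load : sum load ≡ sum weight * α
    total-load = begin
      sum load                                      ≡⟨ ∑-comm (λ x t → weight t * ⟦ D t x ⟧) ⟩
      sum (λ t → sum (λ x → weight t * ⟦ D t x ⟧))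
        ≡⟨ sum-cong-≗ (λ t → *-distribˡ-sum (weight t) (λ x → ⟦ D t x ⟧)) ⟨
      sum (λ t → weight t * card (D t))             ≡⟨ sum-cong-≗ maximum-size ⟩
      sum (λ t → weight t * α)                      ≡⟨ *-distribʳ-sum α weight ⟨
      sum weight * α                                ∎
      where
      open ≡.≡-Reasoning
      maximum-size : ∀ t → weight t * card (D t) ≡ weight t * α
      maximum-size t with ⟦does⟧-cases (maximumAt? t)
      ... | inj₁ wt≡0    = ≡.trans (cong (_* card (D t)) wt≡0) (cong (_* α) (≡.sym wt≡0))
      ... | inj₂ (_ , c) = cong (weight t *_) c

    load-exact : ∀ x → load x * n ≡ α * sum weight
    load-exact x = begin
      load x * n             ≡⟨ *-comm (load x) n ⟩
      n * load x             ≡⟨ sum-const {n} (load x) ⟨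
      sum {n} (λ _ → load x) ≡⟨ sum-cong-≗ (λ y → ≡.sym (load-invariant x y)) ⟩
      sum load               ≡⟨ total-load ⟩
      sum weight * α         ≡⟨ *-comm (sum weight) α ⟩
      α * sum weight         ∎
      where open ≡.≡-Reasoning

    weight-positive : 0 < sum weight
    weight-positive = ≤-trans (≤-reflexive (cong ⟦_⟧ (≡.sym (dec-true (maximumAt? (indexOf J)) J-maximum))))
                              (≤-sum weight (indexOf J))
      where
      J-maximum : IsMaximumAt (indexOf J)
      J-maximum = Independent′-cong G (≡.sym ∘ subsetAt-indexOf J) indJ , card-cong (subsetAt-indexOf J)

    member-large : ∀ t → weight t ≡ 0 ⊎ (Independent′ G (D t) × D t ⊆ full × α * card (full {n}) ≤ card (D t) * n)
    member-large t with ⟦does⟧-cases (maximumAt? t)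
    ... | inj₁ wt≡0      = inj₁ wt≡0
    ... | inj₂ (ind , c) = inj₂ (ind , (λ _ _ → refl) ,
                                  ≤-reflexive (≡.trans (cong (α *_) (card-full {n})) (cong (_* n) (≡.sym c))))

  vertexTransitive⇒tight : Tight (card J) (size G) G full
  vertexTransitive⇒tight =
    (λ I ind _ → ≤-trans (*-monoˡ-≤ n (maxJ I ind)) (≤-reflexive (cong (α *_) (≡.sym (card-full {n}))))) ,
    record { count = 2 ^ n ; member = D ; weight = weight ; weight-positive = weight-positive
           ; member-large = member-large ; load = λ x _ → ≤-reflexive (load-exact x) }

maximum-independent-positive : ∀ K → 0 < size K → ∀ {J : VSet (size K)} →
                               (∀ I → Independent′ K I → card I ≤ card J) → 0 < card J
maximum-independent-positive K size>0 {J} maxJ = begin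
  1              ≡⟨ cong ⟦_⟧ (dec-true (x Fin.≟ x) refl) ⟨
  ⟦ ⁅ x ⁆ x ⟧    ≤⟨ ≤-sum (λ y → ⟦ ⁅ x ⁆ y ⟧) x ⟩
  card ⁅ x ⁆     ≤⟨ maxJ ⁅ x ⁆ independent ⟩
  card J         ∎
  where
  open ≤-Reasoning
  x : Fin (size K)
  x = fromℕ< size>0
  ⁅_⁆ : Fin (size K) → VSet (size K)
  ⁅ x ⁆ y = does (y Fin.≟ x)
  member : ∀ {y} → ⁅ x ⁆ y ≡ true → y ≡ x
  member {y} = does-true (y Fin.≟ x)
  independent : Independent′ K ⁅ x ⁆
  independent u v u≡x v≡x = ≡.trans (cong₂ (adj K) (member u≡x) (member v≡x)) (loopless K x)

-- Disjoint unions

module _ (G H : Graph) where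

  private
    g = size G
    h = size H
    U = union G H

  embed : VSet g → VSet h → VSet (g + h)
  embed P Q z = [ P , Q ]′ (splitAt g z)

  embed-↑ˡ : ∀ P Q x → embed P Q (x ↑ˡ h) ≡ P x
  embed-↑ˡ P Q x = cong [ P , Q ]′ (splitAt-↑ˡ g x h)

  embed-↑ʳ : ∀ P Q y → embed P Q (g ↑ʳ y) ≡ Q y
  embed-↑ʳ P Q y = cong [ P , Q ]′ (splitAt-↑ʳ g h y)

  embed-restrict : ∀ (I : VSet (g + h)) → I ≗ embed (I ∘ (_↑ˡ h)) (I ∘ (g ↑ʳ_))
  embed-restrict I z with splitAt g z in e
  ... | inj₁ x = cong I (≡.sym (splitAt⁻¹-↑ˡ e))
  ... | inj₂ y = cong I (≡.sym (splitAt⁻¹-↑ʳ e))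

  embed-cong : ∀ {P P′ Q Q′} → P ≗ P′ → Q ≗ Q′ → embed P Q ≗ embed P′ Q′
  embed-cong P≗P′ Q≗Q′ z with splitAt g z
  ... | inj₁ x = P≗P′ x
  ... | inj₂ y = Q≗Q′ y

  card-embed : ∀ P Q → card (embed P Q) ≡ card P + card Q
  card-embed P Q = ≡.trans (sum-++ {g} (λ z → ⟦ embed P Q z ⟧))
    (cong₂ _+_ (card-cong (embed-↑ˡ P Q)) (card-cong (embed-↑ʳ P Q)))

  card-embed-∅ʳ : ∀ P → card (embed P ∅) ≡ card P
  card-embed-∅ʳ P = ≡.trans (card-embed P ∅) (≡.trans (cong (card P +_) (card-∅ {h})) (+-identityʳ (card P)))

  card-embed-∅ˡ : ∀ Q → card (embed ∅ Q) ≡ card Q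
  card-embed-∅ˡ Q = ≡.trans (card-embed ∅ Q) (cong (_+ card Q) (card-∅ {g}))

  adj-↑ˡ : ∀ x x′ → adj U (x ↑ˡ h) (x′ ↑ˡ h) ≡ adj G x x′
  adj-↑ˡ x x′ rewrite splitAt-↑ˡ g x h | splitAt-↑ˡ g x′ h = refl

  adj-↑ʳ : ∀ y y′ → adj U (g ↑ʳ y) (g ↑ʳ y′) ≡ adj H y y′
  adj-↑ʳ y y′ rewrite splitAt-↑ʳ g h y | splitAt-↑ʳ g h y′ = refl

  embed-independent : ∀ {P Q} → Independent′ G P → Independent′ H Q → Independent′ U (embed P Q)
  embed-independent indP indQ u v Pu Pv with splitAt g u | splitAt g v
  ... | inj₁ x | inj₁ x′ = indP x x′ Pu Pv
  ... | inj₁ _ | inj₂ _  = refl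
  ... | inj₂ _ | inj₁ _  = refl
  ... | inj₂ y | inj₂ y′ = indQ y y′ Pu Pv

  restrictˡ-independent : ∀ {I} → Independent′ U I → Independent′ G (I ∘ (_↑ˡ h))
  restrictˡ-independent ind x x′ Ix Ix′ = ≡.trans (≡.sym (adj-↑ˡ x x′)) (ind _ _ Ix Ix′)

  restrictʳ-independent : ∀ {I} → Independent′ U I → Independent′ H (I ∘ (g ↑ʳ_))
  restrictʳ-independent ind y y′ Iy Iy′ = ≡.trans (≡.sym (adj-↑ʳ y y′)) (ind _ _ Iy Iy′)

  embed-mono : ∀ {P P′ Q Q′} → P ⊆ P′ → Q ⊆ Q′ → embed P Q ⊆ embed P′ Q′
  embed-mono P⊆P′ Q⊆Q′ z with splitAt g z
  ... | inj₁ x = P⊆P′ x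
  ... | inj₂ y = Q⊆Q′ y

  Closed-embed : ∀ {A B} → Closed G A → Closed H B → Closed U (embed A B)
  Closed-embed clA clB u v Au uv with splitAt g u | splitAt g v
  ... | inj₁ x | inj₁ x′ = clA x x′ Au uv
  ... | inj₂ y | inj₂ y′ = clB y y′ Au uv

  adj-↑ˡ↑ʳ : ∀ x y → adj U (x ↑ˡ h) (g ↑ʳ y) ≡ false
  adj-↑ˡ↑ʳ x y rewrite splitAt-↑ˡ g x h | splitAt-↑ʳ g h y = refl

  adj-↑ʳ↑ˡ : ∀ y x → adj U (g ↑ʳ y) (x ↑ˡ h) ≡ false
  adj-↑ʳ↑ˡ y x rewrite splitAt-↑ʳ g h y | splitAt-↑ˡ g x h = refl

  data Side : Fin (g + h) → Set where
    left  : ∀ x → Side (x ↑ˡ h)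
    right : ∀ y → Side (g ↑ʳ y)

  side : ∀ z → Side z
  side z with splitAt g z in e
  ... | inj₁ x rewrite ≡.sym (splitAt⁻¹-↑ˡ e) = left x
  ... | inj₂ y rewrite ≡.sym (splitAt⁻¹-↑ʳ e) = right y

  N′-embed : ∀ P Q → N′ U (embed P Q) ≗ embed (N′ G P) (N′ H Q)
  N′-embed P Q z with side z
  ... | left x  = ≡.trans (bool-ext to from) (≡.sym (embed-↑ˡ (N′ G P) (N′ H Q) x))
    where
    to : N′ U (embed P Q) (x ↑ˡ h) ≡ true → N′ G P x ≡ true
    to Nz with N′-elim U (embed P Q) (x ↑ˡ h) Nz
    ... | u , Pu , ux with side u
    ...   | left x′  = N′-intro G P x′ x (≡.trans (≡.sym (embed-↑ˡ P Q x′)) Pu) (≡.trans (≡.sym (adj-↑ˡ x′ x)) ux)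
    ...   | right y′ = ⊥-elim (true≢false (≡.trans (≡.sym ux) (adj-↑ʳ↑ˡ y′ x)))
    from : N′ G P x ≡ true → N′ U (embed P Q) (x ↑ˡ h) ≡ true
    from Nx with N′-elim G P x Nx
    ... | x′ , Px′ , x′x =
      N′-intro U (embed P Q) (x′ ↑ˡ h) (x ↑ˡ h) (≡.trans (embed-↑ˡ P Q x′) Px′) (≡.trans (adj-↑ˡ x′ x) x′x)
  ... | right y = ≡.trans (bool-ext to from) (≡.sym (embed-↑ʳ (N′ G P) (N′ H Q) y))
    where
    to : N′ U (embed P Q) (g ↑ʳ y) ≡ true → N′ H Q y ≡ true
    to Nz with N′-elim U (embed P Q) (g ↑ʳ y) Nz
    ... | u , Qu , uy with side u
    ...   | right y′ = N′-intro H Q y′ y (≡.trans (≡.sym (embed-↑ʳ P Q y′)) Qu) (≡.trans (≡.sym (adj-↑ʳ y′ y)) uy)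
    ...   | left x′  = ⊥-elim (true≢false (≡.trans (≡.sym uy) (adj-↑ˡ↑ʳ x′ y)))
    from : N′ H Q y ≡ true → N′ U (embed P Q) (g ↑ʳ y) ≡ true
    from Ny with N′-elim H Q y Ny
    ... | y′ , Qy′ , y′y =
      N′-intro U (embed P Q) (g ↑ʳ y′) (g ↑ʳ y) (≡.trans (embed-↑ʳ P Q y′) Qy′) (≡.trans (adj-↑ʳ y′ y) y′y)

  union-tight : ∀ {p q W₁ W₂} → Tight p q G W₁ → Tight p q H W₂ → Tight p q U (embed W₁ W₂)
  union-tight {p} {q} {W₁} {W₂} (bound₁ , cover₁) (bound₂ , cover₂) = bound , record
    { count           = C₁.count * C₂.count
    ; member          = member
    ; weight          = weight
    ; weight-positive = ≡.subst (0 <_) (≡.sym (sum-pairs C₁.weight C₂.weight))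
                                (*-mono-< C₁.weight-positive C₂.weight-positive)
    ; member-large    = λ k → member-large (proj₁ (split k)) (proj₂ (split k))
    ; load            = load
    }
    where
    module C₁ = FractionalCover cover₁
    module C₂ = FractionalCover cover₂
    open ≤-Reasoning
    card-W : card (embed W₁ W₂) ≡ card W₁ + card W₂
    card-W = card-embed W₁ W₂
    bound : IndepRatio≤ p q U (embed W₁ W₂)
    bound I ind I⊆W = begin
      card I * q                   ≡⟨ cong (_* q) (≡.trans (card-cong (embed-restrict I)) (card-embed _ _)) ⟩
      (card I₁ + card I₂) * q      ≡⟨ *-distribʳ-+ q (card I₁) (card I₂) ⟩
      card I₁ * q + card I₂ * q
        ≤⟨ +-mono-≤ (bound₁ I₁ (restrictˡ-independent ind) (λ x → ≡.trans (≡.sym (embed-↑ˡ W₁ W₂ x)) ∘ I⊆W _))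
                    (bound₂ I₂ (restrictʳ-independent ind) (λ y → ≡.trans (≡.sym (embed-↑ʳ W₁ W₂ y)) ∘ I⊆W _)) ⟩
      p * card W₁ + p * card W₂    ≡⟨ ≡.trans (cong (p *_) card-W) (*-distribˡ-+ p (card W₁) (card W₂)) ⟨
      p * card (embed W₁ W₂)       ∎
      where
      I₁ = I ∘ (_↑ˡ h)
      I₂ = I ∘ (g ↑ʳ_)
    split : Fin (C₁.count * C₂.count) → Fin C₁.count × Fin C₂.count
    split = remQuot C₂.count
    member : Fin (C₁.count * C₂.count) → VSet (g + h)
    member k = let (t , s) = split k in embed (C₁.member t) (C₂.member s)
    weight : Fin (C₁.count * C₂.count) → ℕ
    weight k = let (t , s) = split k in C₁.weight t * C₂.weight s
    member-large : ∀ t s → C₁.weight t * C₂.weight s ≡ 0 ⊎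
      (Independent′ U (embed (C₁.member t) (C₂.member s)) × embed (C₁.member t) (C₂.member s) ⊆ embed W₁ W₂ ×
       p * card (embed W₁ W₂) ≤ card (embed (C₁.member t) (C₂.member s)) * q)
    member-large t s with C₁.member-large t | C₂.member-large s
    ... | inj₁ w₁≡0 | _         = inj₁ (cong (_* C₂.weight s) w₁≡0)
    ... | inj₂ _    | inj₁ w₂≡0 = inj₁ (≡.trans (cong (C₁.weight t *_) w₂≡0) (*-zeroʳ (C₁.weight t)))
    ... | inj₂ (ind₁ , J⊆W₁ , large₁) | inj₂ (ind₂ , J⊆W₂ , large₂) =
      inj₂ (embed-independent ind₁ ind₂ , embed-mono J⊆W₁ J⊆W₂ , (begin
        p * card (embed W₁ W₂)     ≡⟨ ≡.trans (cong (p *_) card-W) (*-distribˡ-+ p (card W₁) (card W₂)) ⟩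
        p * card W₁ + p * card W₂  ≤⟨ +-mono-≤ large₁ large₂ ⟩
        card A * q + card B * q    ≡⟨ ≡.trans (cong (_* q) (card-embed A B)) (*-distribʳ-+ q (card A) (card B)) ⟨
        card (embed A B) * q       ∎))
      where
      A = C₁.member t
      B = C₂.member s
    load : ∀ z → embed W₁ W₂ z ≡ true → sum (λ k → weight k * ⟦ member k z ⟧) * q ≤ p * sum weight
    load z Wz with side z
    ... | left x = sum-pairs-≤ˡ C₁.weight C₂.weight (λ t s → ⟦ embed (C₁.member t) (C₂.member s) (x ↑ˡ h) ⟧) {p} {q}
      (λ t → ⟦ C₁.member t x ⟧)
      (λ t s → ≡.trans (cong (λ b → C₁.weight t * C₂.weight s * ⟦ b ⟧) (embed-↑ˡ _ _ x))
                        (solve 3 (λ a b c → a :* b :* c := a :* c :* b) refl (C₁.weight t) (C₂.weight s) ⟦ C₁.member t x ⟧))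
      (C₁.load x (≡.trans (≡.sym (embed-↑ˡ W₁ W₂ x)) Wz))
    ... | right y = sum-pairs-≤ʳ C₁.weight C₂.weight (λ t s → ⟦ embed (C₁.member t) (C₂.member s) (g ↑ʳ y) ⟧) {p} {q}
      (λ s → ⟦ C₂.member s y ⟧)
      (λ t s → ≡.trans (cong (λ b → C₁.weight t * C₂.weight s * ⟦ b ⟧) (embed-↑ʳ _ _ y))
                        (*-assoc (C₁.weight t) (C₂.weight s) ⟦ C₂.member s y ⟧))
      (C₂.load y (≡.trans (≡.sym (embed-↑ʳ W₁ W₂ y)) Wz))

  left-right-disjoint : Disjoint (embed full ∅) (embed ∅ full)
  left-right-disjoint z _ with splitAt g z
  ... | inj₁ _ = refl

  right-left-disjoint : Disjoint (embed ∅ full) (embed full ∅)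
  right-left-disjoint z _ with splitAt g z
  ... | inj₂ _ = refl

  left∪right : ∀ z → (embed full ∅ ∪ embed ∅ full) z ≡ true
  left∪right z with splitAt g z
  ... | inj₁ _ = refl
  ... | inj₂ _ = refl

  right∪left : ∀ z → (embed ∅ full ∪ embed full ∅) z ≡ true
  right∪left z with splitAt g z
  ... | inj₁ _ = refl
  ... | inj₂ _ = refl

  card-N′-embed-∅ʳ : ∀ P → card (N′ U (embed P ∅)) ≡ card (N′ G P)
  card-N′-embed-∅ʳ P = ≡.trans (card-cong (N′-embed P ∅))
    (≡.trans (card-cong (embed-cong (λ _ → refl) (N′-∅ H))) (card-embed-∅ʳ (N′ G P)))

  card-N′-embed-∅ˡ : ∀ Q → card (N′ U (embed ∅ Q)) ≡ card (N′ H Q)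
  card-N′-embed-∅ˡ Q = ≡.trans (card-cong (N′-embed ∅ Q))
    (≡.trans (card-cong (embed-cong (N′-∅ G) (λ _ → refl))) (card-embed-∅ˡ (N′ H Q)))

-- Powers

-- A vertex partition X ⊔ Y of U into unions of components, tight with ratios p/q and p′/q ≤ p/q,
-- induces the partition of U^(n+1) into P n = Y^(n+1) and the rest E n; both stay tight.
module Powers {p p′ q} (q>0 : 0 < q) (p′≤p : p′ ≤ p) (U : Graph) {X Y : VSet (size U)}
  (clX : Closed U X) (clY : Closed U Y) (disj : Disjoint X Y) (X∪Y : ∀ x → (X ∪ Y) x ≡ true)
  (tightX : Tight p q U X) (tightY : Tight p′ q U Y) where

  E P : ∀ n → VSet (size (power U n))
  E zero    = X
  E (suc n) = E n ⊗ (X ∪ Y) ∪ P n ⊗ X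
  P zero    = Y
  P (suc n) = P n ⊗ Y

  private
    nbhdX : NbhdRatio≤ p q U X
    nbhdX = tight⇒nbhdRatio≤ {p} {q} q>0 clX tightX

    nbhdY : NbhdRatio≤ p′ q U Y
    nbhdY = tight⇒nbhdRatio≤ {p′} {q} q>0 clY tightY

    nbhdX∪Y : NbhdRatio≤ p q U (X ∪ Y)
    nbhdX∪Y = ∪-nbhdRatio≤ U clX clY disj {p} {q} nbhdX (NbhdRatio≤-mono {p′} {p} {q} {U} {Y} p′≤p nbhdY)

  record Invariant (n : ℕ) : Set where
    field
      closedE : Closed (power U n) (E n)
      closedP : Closed (power U n) (P n)
      disjoint : Disjoint (E n) (P n)
      covers  : ∀ z → (E n ∪ P n) z ≡ true
      tightE  : Tight p q (power U n) (E n)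
      tightP  : Tight p′ q (power U n) (P n)

  invariant : ∀ n → Invariant n
  nbhdP-mono : ∀ n → NbhdRatio≤ p q (power U n) (P n)
  invariant zero = record
    { closedE = clX ; closedP = clY ; disjoint = disj ; covers = X∪Y ; tightE = tightX ; tightP = tightY }
  invariant (suc n) = record
    { closedE  = Closed-∪ V closed₁ closed₂
    ; closedP  = Closed-⊗ K U closedP clY
    ; disjoint = disjoint′
    ; covers   = covers′
    ; tightE   = ∪-tight V closed₁ closed₂ disjoint₁₂
                   (tensor-tightˡ {K = K} {U} q>0 closedE (Closed-∪ U clX clY) tightE nbhdX∪Y)
                   (tensor-tightʳ {K = K} {U} q>0 closedP clX (nbhdP-mono n) tightX)
    ; tightP   = tensor-tightˡ {K = K} {U} q>0 closedP clY tightP nbhdY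
    }
    where
    open Invariant (invariant n)
    K = power U n
    V = tensor K U
    closed₁ : Closed V (E n ⊗ (X ∪ Y))
    closed₁ = Closed-⊗ K U closedE (Closed-∪ U clX clY)
    closed₂ : Closed V (P n ⊗ X)
    closed₂ = Closed-⊗ K U closedP clX
    disjoint₁₂ : Disjoint (E n ⊗ (X ∪ Y)) (P n ⊗ X)
    disjoint₁₂ z e = cong (_∧ _) (disjoint _ (∧-conicalˡ _ _ e))
    disjoint′ : Disjoint (E n ⊗ (X ∪ Y) ∪ P n ⊗ X) (P n ⊗ Y)
    disjoint′ z e with ∨-elim ((E n ⊗ (X ∪ Y)) z) _ e
    ... | inj₁ e₁ = cong (_∧ _) (disjoint _ (∧-conicalˡ _ _ e₁))
    ... | inj₂ e₂ = ≡.trans (cong (P n _ ∧_) (disj _ (∧-conicalʳ _ _ e₂))) (∧-zeroʳ _)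
    covers′ : ∀ z → ((E n ⊗ (X ∪ Y) ∪ P n ⊗ X) ∪ P n ⊗ Y) z ≡ true
    covers′ z with ∨-elim (E n (proj₁ (remQuot {size K} (size U) z))) _ (covers _)
                 | ∨-elim (X (proj₂ (remQuot {size K} (size U) z))) _ (X∪Y _)
    ... | inj₁ Ez | _       = ∨-introˡ _ (∨-introˡ _ (∧-intro Ez (X∪Y _)))
    ... | inj₂ Pz | inj₁ Xz = ∨-introˡ _ (∨-introʳ ((E n ⊗ (X ∪ Y)) z) (∧-intro Pz Xz))
    ... | inj₂ Pz | inj₂ Yz = ∨-introʳ ((E n ⊗ (X ∪ Y) ∪ P n ⊗ X) z) (∧-intro Pz Yz)

  nbhdP-mono n = NbhdRatio≤-mono {p′} {p} {q} {power U n} {P n} p′≤p (tight⇒nbhdRatio≤ {p′} {q} q>0 closedP tightP)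
    where open Invariant (invariant n)

  independent-bound : ∀ n I → Independent′ (power U n) I → card I * q ≤ p * size (power U n)
  independent-bound n I ind = ≡.subst (λ k → card I * q ≤ p * k) (≡.trans (card-cong covers) (card-full {size (power U n)}))
    (nbhdRatio≤⇒indepRatio≤ {p} {q} {K} {E n ∪ P n} (Closed-∪ K closedE closedP)
      (∪-nbhdRatio≤ K closedE closedP disjoint {p} {q} (tight⇒nbhdRatio≤ {p} {q} {K} {E n} q>0 closedE tightE) (nbhdP-mono n))
      I ind (λ z _ → covers z))
    where
    open Invariant (invariant n)
    K = power U n

  large-independent : ∀ n → ∃ λ I → Independent′ (power U n) I × p * card (E n) ≤ card I * q
  large-independent n = let (I , ind , _ , large) = FractionalCover.large-member (proj₂ tightE) in I , ind , large
    where open Invariant (invariant n)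

  card-E+P : ∀ n → card (E n) + card (P n) ≡ size (power U n)
  card-E+P n = ≡.trans (≡.sym (card-∪ disjoint)) (≡.trans (card-cong covers) (card-full {size (power U n)}))
    where open Invariant (invariant n)

  card-P : ∀ n → card (P n) ≡ card Y ^ suc n
  card-P zero    = ≡.sym (*-identityʳ (card Y))
  card-P (suc n) = ≡.trans (card-⊗ (P n) Y) (≡.trans (cong (_* card Y) (card-P n)) (*-comm (card Y ^ suc n) (card Y)))

-- Integer literals +_ are opened only here: elsewhere they would clash with sections (x +_).
module _ where
  open import Data.Integer using (+_; -[1+_])

  private
    frac-toℚᵘ : ∀ a b → ℚ.toℚᵘ (frac a (suc b)) ℚᵘ.≃ mkℚᵘ (+ a) b
    frac-toℚᵘ a b = ℚ.toℚᵘ-fromℚᵘ (mkℚᵘ (+ a) b)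

    pos-* : ∀ m n → + m ℤ.* + n ≡ + (m * n)
    pos-* m n = ≡.sym (ℤ.pos-* m n)

  frac-≤ : ∀ {a b c d} → 0 < b → 0 < d → a * d ≤ c * b → frac a b ≤ℚ frac c d
  frac-≤ {a} {suc b} {c} {suc d} _ _ ad≤cb = ℚ.toℚᵘ-cancel-≤
    (ℚᵘ.≤-respˡ-≃ (ℚᵘ.≃-sym (frac-toℚᵘ a b)) (ℚᵘ.≤-respʳ-≃ (ℚᵘ.≃-sym (frac-toℚᵘ c d))
      (ℚᵘ.*≤* (≡.subst₂ ℤ._≤_ (≡.sym (pos-* a (suc d))) (≡.sym (pos-* c (suc b))) (ℤ.+≤+ ad≤cb)))))

  frac-≡ : ∀ {a b c d} → 0 < b → 0 < d → a * d ≡ c * b → frac a b ≡ frac c d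
  frac-≡ {a} {suc b} {c} {suc d} _ _ ad≡cb = ℚ.fromℚᵘ-cong {mkℚᵘ (+ a) b} {mkℚᵘ (+ c) d}
    (ℚᵘ.*≡* (≡.trans (pos-* a (suc d)) (≡.trans (cong +_ ad≡cb) (≡.sym (pos-* c (suc b))))))

  positive-numerator : ∀ ε → 0ℚ <ℚ ε → ∃ λ num → ∃ λ den → ℚ.toℚᵘ ε ≡ mkℚᵘ (+ suc num) den
  positive-numerator (mkℚ (+ suc n) d _) _ = n , d , refl
  positive-numerator (mkℚ (+ zero) d _) (ℚ.*<* (ℤ.+<+ ()))
  positive-numerator (mkℚ -[1+ n ] d _) (ℚ.*<* ())

  -- |k/S - p/q| = (pS - kq)/(Sq) when kq ≤ pS, compared with ε = (num+1)/(den+1).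
  ∣frac-frac∣< : ∀ {k S p q num den} (ε : ℚ) → ℚ.toℚᵘ ε ≡ mkℚᵘ (+ suc num) den → 0 < S → 0 < q →
                 k * q ≤ p * S → (p * S ∸ k * q) * suc den < suc num * (S * q) →
                 ∣ frac k S -ℚ frac p q ∣ℚ <ℚ ε
  ∣frac-frac∣< {k} {suc S′} {p} {suc q′} {num} {den} ε ε≡ _ _ kq≤pS small =
    ℚ.toℚᵘ-cancel-< (≡.subst (ℚ.toℚᵘ ∣ frac k S -ℚ frac p q ∣ℚ ℚᵘ.<_) (≡.sym ε≡)
      (ℚᵘ.<-respˡ-≃ (ℚᵘ.≃-sym toℚᵘ-distance) (ℚᵘ.*<* cross)))
    where
    S = suc S′
    q = suc q′
    X = mkℚᵘ (+ k) S′
    Y = mkℚᵘ (+ p) q′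
    toℚᵘ-distance : ℚ.toℚᵘ ∣ frac k S -ℚ frac p q ∣ℚ ℚᵘ.≃ ℚᵘ.∣ X ℚᵘ.- Y ∣
    toℚᵘ-distance = ℚᵘ.≃-trans (ℚ.toℚᵘ-homo-∣-∣ (frac k S -ℚ frac p q)) (ℚᵘ.∣-∣-cong
      (ℚᵘ.≃-trans (ℚ.toℚᵘ-homo-+ (frac k S) (ℚ.- frac p q))
        (ℚᵘ.+-cong (frac-toℚᵘ k S′)
          (ℚᵘ.≃-trans (ℚ.toℚᵘ-homo‿- (frac p q)) (ℚᵘ.-‿cong (frac-toℚᵘ p q′))))))
    numerator : ℤ.∣ + k ℤ.* + q ℤ.+ (ℤ.- + p) ℤ.* + S ∣ ≡ p * S ∸ k * q
    numerator = begin
      ℤ.∣ + k ℤ.* + q ℤ.+ (ℤ.- + p) ℤ.* + S ∣  ≡⟨ cong ℤ.∣_∣ (cong₂ ℤ._+_ (pos-* k q)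
                                                   (≡.trans (≡.sym (ℤ.neg-distribˡ-* (+ p) (+ S))) (cong ℤ.-_ (pos-* p S)))) ⟩
      ℤ.∣ + (k * q) ℤ.+ ℤ.- + (p * S) ∣          ≡⟨ cong ℤ.∣_∣ (ℤ.m-n≡m⊖n (k * q) (p * S)) ⟩
      ℤ.∣ (k * q) ℤ.⊖ (p * S) ∣                  ≡⟨ cong ℤ.∣_∣ (ℤ.⊖-≤ kq≤pS) ⟩
      ℤ.∣ ℤ.- + (p * S ∸ k * q) ∣                ≡⟨ ℤ.∣-i∣≡∣i∣ (+ (p * S ∸ k * q)) ⟩
      p * S ∸ k * q                              ∎
      where open ≡.≡-Reasoning
    cross : ℚᵘ.↥ ℚᵘ.∣ X ℚᵘ.- Y ∣ ℤ.* ℚᵘ.↧ (mkℚᵘ (+ suc num) den) ℤ.<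
            ℚᵘ.↥ (mkℚᵘ (+ suc num) den) ℤ.* ℚᵘ.↧ ℚᵘ.∣ X ℚᵘ.- Y ∣
    cross rewrite numerator | pos-* (p * S ∸ k * q) (suc den) | pos-* (suc num) (S * q) = ℤ.+<+ small

polynomial≤exponential : ∀ {b c} → b < c → ∀ n → suc n * b ^ n ≤ c ^ suc n
polynomial≤exponential {b} {c} b<c zero = ≤-trans (≤-trans (s≤s z≤n) b<c) (≤-reflexive (≡.sym (*-identityʳ c)))
polynomial≤exponential {b} {c} b<c (suc n) = begin
  suc (suc n) * (b * b ^ n)
    ≡⟨ solve 3 (λ n b x → (con 2 :+ n) :* (b :* x) := (con 1 :+ n) :* x :* b :+ b :* x) refl n b (b ^ n) ⟩
  suc n * b ^ n * b + b ^ suc n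
    ≤⟨ +-mono-≤ (*-monoˡ-≤ b (polynomial≤exponential b<c n)) (^-monoˡ-≤ (suc n) (<⇒≤ b<c)) ⟩
  c ^ suc n * b + c ^ suc n           ≡⟨ solve 2 (λ x b → x :* b :+ x := (con 1 :+ b) :* x) refl (c ^ suc n) b ⟩
  suc b * c ^ suc n                   ≤⟨ *-monoˡ-≤ (c ^ suc n) b<c ⟩
  c ^ suc (suc n)                     ∎
  where open ≤-Reasoning

geometric-domination : ∀ {b c} → b < c → ∀ D → ∃ λ M → ∀ n → M ≤ n → b ^ suc n * D < c ^ suc n
geometric-domination {b} {c} b<c D = b * D , λ n bD≤n → *-cancelʳ-< (suc n) _ _ (begin-strict
  b ^ suc n * D * suc n
    ≡⟨ solve 4 (λ b x D n → b :* x :* D :* (con 1 :+ n) := b :* D :* ((con 1 :+ n) :* x)) refl b (b ^ n) D n ⟩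
  b * D * (suc n * b ^ n)        ≤⟨ *-monoʳ-≤ (b * D) (polynomial≤exponential b<c n) ⟩
  b * D * c ^ suc n              ≤⟨ *-monoˡ-≤ (c ^ suc n) bD≤n ⟩
  n * c ^ suc n
    <⟨ *-monoˡ-< (c ^ suc n) {{>-nonZero (m^n>0 c {{>-nonZero (≤-<-trans z≤n b<c)}} (suc n))}} (n<1+n n) ⟩
  suc n * c ^ suc n              ≡⟨ *-comm (suc n) (c ^ suc n) ⟩
  c ^ suc n * suc n              ∎)
  where open ≤-Reasoning

size-power : ∀ U n → size (power U n) ≡ size U ^ suc n
size-power U zero    = ≡.sym (*-identityʳ (size U))
size-power U (suc n) = ≡.trans (cong (_* size U) (size-power U n)) (*-comm (size U ^ suc n) (size U))

HasA-criterion : ∀ U {p q b} → b < size U → 0 < q →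
  (∀ n I → Independent′ (power U n) I → card I * q ≤ p * size (power U n)) →
  (∀ n → ∃ λ I → Independent′ (power U n) I × p * size (power U n) ≤ card I * q + q * b ^ suc n) →
  HasA U (frac p q)
HasA-criterion U {p} {q} {b} b<size q>0 upper lower ε ε>0 with positive-numerator ε ε>0
... | num , den , ε≡ with geometric-domination b<size (suc den)
... | M , dominated = M , λ n M≤n k ((I , indI , ∣I∣≡k) , maximal) →
  ∣frac-frac∣< ε ε≡ (size-positive n) q>0 (kq≤pS n k I indI ∣I∣≡k) (small n M≤n k maximal)
  where
  S : ℕ → ℕ
  S n = size (power U n)
  size-positive : ∀ n → 0 < S n
  size-positive n = ≡.subst (0 <_) (≡.sym (size-power U n)) (m^n>0 (size U) {{>-nonZero (≤-<-trans z≤n b<size)}} (suc n))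
  kq≤pS : ∀ n k I → Independent (power U n) I → ∣ I ∣ ≡ k → k * q ≤ p * S n
  kq≤pS n k I indI ∣I∣≡k = ≡.subst (λ c → c * q ≤ p * S n) (≡.trans (≡.sym (card-lookup I)) ∣I∣≡k)
    (upper n (lookup I) (Independent⇒Independent′ (power U n) indI))
  small : ∀ n → M ≤ n → ∀ k → (∀ I → Independent (power U n) I → ∣ I ∣ ≤ k) →
          (p * S n ∸ k * q) * suc den < suc num * (S n * q)
  small n M≤n k maximal with lower n
  ... | I , indI , pS≤ = begin-strict
    (p * S n ∸ k * q) * suc den
      ≤⟨ *-monoˡ-≤ (suc den) (m≤n+o⇒m∸n≤o (p * S n) (k * q)
           (≤-trans pS≤ (+-monoˡ-≤ (q * b ^ suc n) (*-monoˡ-≤ q ∣I∣≤k)))) ⟩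
    q * b ^ suc n * suc den        ≡⟨ *-assoc q (b ^ suc n) (suc den) ⟩
    q * (b ^ suc n * suc den)
      <⟨ *-monoʳ-< q {{>-nonZero q>0}} (≡.subst (b ^ suc n * suc den <_) (≡.sym (size-power U n)) (dominated n M≤n)) ⟩
    q * S n                        ≡⟨ *-comm q (S n) ⟩
    S n * q                        ≤⟨ m≤n*m (S n * q) (suc num) ⟩
    suc num * (S n * q)            ∎
    where
    open ≤-Reasoning
    ∣I∣≤k : card I ≤ k
    ∣I∣≤k = ≤-trans (≤-reflexive (≡.sym (card-tabulate I)))
                    (maximal (tabulate I) (Independent′⇒Independent (power U n) indI))

Hasa-criterion : ∀ U {p q} → 0 < q → NbhdRatio≤ p q U full →
  ∀ I₀ → Independent′ U I₀ → 0 < card I₀ → card I₀ * q ≡ p * (card I₀ + card (N′ U I₀)) →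
  Hasa U (frac p q)
Hasa-criterion U {p} {q} q>0 bound I₀ ind₀ I₀>0 exact =
  (tabulate I₀ , Independent′⇒Independent U ind₀ , nonempty , attained) , below
  where
  card-N-tabulate : card (N′ U (lookup (tabulate I₀))) ≡ card (N′ U I₀)
  card-N-tabulate = card-cong (N′-cong U (lookup∘tabulate I₀))
  nonempty : Nonempty (tabulate I₀)
  nonempty = let (x , I₀x) = card-positive I₀ I₀>0 in x , lookup⇒[]= x (tabulate I₀) (≡.trans (lookup∘tabulate I₀ x) I₀x)
  attained : ratio U (tabulate I₀) ≡ frac p q
  attained rewrite card-tabulate I₀ | card-tabulate (N′ U (lookup (tabulate I₀))) | card-N-tabulate =
    frac-≡ (≤-trans I₀>0 (m≤m+n _ _)) q>0 exact
  below : ∀ I → Independent U I → Nonempty I → ratio U I ≤ℚ frac p q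
  below I ind ne rewrite card-lookup I | card-tabulate (N′ U (lookup I)) =
    frac-≤ (≤-trans (Nonempty⇒card-positive I ne) (m≤m+n _ _)) q>0
      (bound (lookup I) (Independent⇒Independent′ U ind) (λ _ _ → refl))

module Partition {p p′ q} (U : Graph) {X Y : VSet (size U)} (q>0 : 0 < q) (p′≤p : p′ ≤ p)
  (clX : Closed U X) (clY : Closed U Y) (disj : Disjoint X Y) (X∪Y : ∀ x → (X ∪ Y) x ≡ true)
  (tightX : Tight p q U X) (tightY : Tight p′ q U Y) where

  open Powers q>0 p′≤p U clX clY disj X∪Y tightX tightY

  hasA : p ≤ q → card Y < size U → HasA U (frac p q)
  hasA p≤q Y<U = HasA-criterion U Y<U q>0 independent-bound λ n →
    let (I , ind , large) = large-independent n in I , ind , (begin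
      p * size (power U n)             ≡⟨ cong (p *_) (card-E+P n) ⟨
      p * (card (E n) + card (P n))    ≡⟨ *-distribˡ-+ p (card (E n)) (card (P n)) ⟩
      p * card (E n) + p * card (P n)  ≤⟨ +-mono-≤ large (*-monoˡ-≤ (card (P n)) p≤q) ⟩
      card I * q + q * card (P n)      ≡⟨ cong (λ c → card I * q + q * c) (card-P n) ⟩
      card I * q + q * card Y ^ suc n  ∎)
    where open ≤-Reasoning

  nbhdRatio≤ : NbhdRatio≤ p q U full
  nbhdRatio≤ I ind _ = ∪-nbhdRatio≤ U clX clY disj {p} {q}
    (tight⇒nbhdRatio≤ {p} {q} {U} {X} q>0 clX tightX)
    (NbhdRatio≤-mono {p′} {p} {q} {U} {Y} p′≤p (tight⇒nbhdRatio≤ {p′} {q} {U} {Y} q>0 clY tightY))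
    I ind (λ x _ → X∪Y x)

  hasA×Hasa : p ≤ q → card Y < size U →
    ∀ I₀ → Independent′ U I₀ → 0 < card I₀ → card I₀ * q ≡ p * (card I₀ + card (N′ U I₀)) →
    HasA U (frac p q) × Hasa U (frac p q)
  hasA×Hasa p≤q Y<U I₀ ind₀ I₀>0 exact = hasA p≤q Y<U , Hasa-criterion U q>0 nbhdRatio≤ I₀ ind₀ I₀>0 exact

module VertexTransitiveGraph (G : Graph) (vt : VertexTransitive G) (G>0 : 0 < size G) where

  private
    maximum = maximum-independent G

  J : VSet (size G)
  J = proj₁ maximum

  α : ℕ
  α = card J

  J-independent : Independent′ G J
  J-independent = proj₁ (proj₂ maximum)

  tight : Tight α (size G) G full
  tight = vertexTransitive⇒tight G vt J-independent (proj₂ (proj₂ maximum))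

  α>0 : 0 < α
  α>0 = maximum-independent-positive G G>0 (proj₂ (proj₂ maximum))

  α≤size : α ≤ size G
  α≤size = card≤size J

  card-closedNbhd-J : α + card (N′ G J) ≡ size G
  card-closedNbhd-J = ≤-antisym
    (≤-trans (≤-reflexive (≡.sym (card-closedNbhd G J-independent))) (card≤size _))
    (*-cancelˡ-≤ α {{>-nonZero α>0}}
      (tight⇒nbhdRatio≤ {α} {size G} {G} {full} G>0 (Closed-full G) tight J J-independent (λ _ _ → refl)))

  hasA : HasA G (frac α (size G))
  hasA = Partition.hasA G {full} {∅} G>0 z≤n (Closed-full G) (Closed-∅ G) (λ _ _ → refl) (λ _ → refl)
           tight (tight-∅ G) α≤size (≡.subst (_< size G) (≡.sym (card-∅ {size G})) G>0)

module UnionOfVertexTransitive (G H : Graph) (vtG : VertexTransitive G) (vtH : VertexTransitive H)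
  (G>0 : 0 < size G) (H>0 : 0 < size H) where

  module 𝔾 = VertexTransitiveGraph G vtG G>0
  module ℍ = VertexTransitiveGraph H vtH H>0

  private
    g = size G
    h = size H
    U = union G H
    L R : VSet (g + h)
    L = embed G H full ∅
    R = embed G H ∅ full

    gh>0 : 0 < g * h
    gh>0 = *-mono-< G>0 H>0

    closedL : Closed U L
    closedL = Closed-embed G H (Closed-full G) (Closed-∅ H)

    closedR : Closed U R
    closedR = Closed-embed G H (Closed-∅ G) (Closed-full H)

    tightL : Tight (𝔾.α * h) (g * h) U L
    tightL = union-tight G H (tight-scale h 𝔾.tight) (tight-∅ H)

    tightR : Tight (ℍ.α * g) (g * h) U R
    tightR = union-tight G H (tight-∅ G)
               (≡.subst (λ q → Tight (ℍ.α * g) q H full) (*-comm h g) (tight-scale g ℍ.tight))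

    rotate : ∀ a g h → a * (g * h) ≡ a * h * g
    rotate = solve 3 (λ a g h → a :* (g :* h) := a :* h :* g) refl

    witnessL : VSet (g + h)
    witnessL = embed G H 𝔾.J ∅

    witnessR : VSet (g + h)
    witnessR = embed G H ∅ ℍ.J

    card-witnessL : card witnessL ≡ 𝔾.α
    card-witnessL = card-embed-∅ʳ G H 𝔾.J

    card-witnessR : card witnessR ≡ ℍ.α
    card-witnessR = card-embed-∅ˡ G H ℍ.J

    exactL : card witnessL * (g * h) ≡ 𝔾.α * h * (card witnessL + card (N′ U witnessL))
    exactL = begin
      card witnessL * (g * h)                             ≡⟨ cong (_* (g * h)) card-witnessL ⟩
      𝔾.α * (g * h)                                       ≡⟨ rotate 𝔾.α g h ⟩
      𝔾.α * h * g                                         ≡⟨ cong (𝔾.α * h *_) 𝔾.card-closedNbhd-J ⟨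
      𝔾.α * h * (𝔾.α + card (N′ G 𝔾.J))
        ≡⟨ cong₂ (λ a b → 𝔾.α * h * (a + b)) card-witnessL (card-N′-embed-∅ʳ G H 𝔾.J) ⟨
      𝔾.α * h * (card witnessL + card (N′ U witnessL))    ∎
      where open ≡.≡-Reasoning

    exactR : card witnessR * (g * h) ≡ ℍ.α * g * (card witnessR + card (N′ U witnessR))
    exactR = begin
      card witnessR * (g * h)                             ≡⟨ cong (_* (g * h)) card-witnessR ⟩
      ℍ.α * (g * h)                                       ≡⟨ *-assoc ℍ.α g h ⟨
      ℍ.α * g * h                                         ≡⟨ cong (ℍ.α * g *_) ℍ.card-closedNbhd-J ⟨
      ℍ.α * g * (ℍ.α + card (N′ H ℍ.J))
        ≡⟨ cong₂ (λ a b → ℍ.α * g * (a + b)) card-witnessR (card-N′-embed-∅ˡ G H ℍ.J) ⟨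
      ℍ.α * g * (card witnessR + card (N′ U witnessR))    ∎
      where open ≡.≡-Reasoning

    L<U : card L < g + h
    L<U = ≡.subst (_< g + h) (≡.sym (≡.trans (card-embed-∅ʳ G H full) (card-full {g}))) (m<m+n g H>0)

    R<U : card R < g + h
    R<U = ≡.subst (_< g + h) (≡.sym (≡.trans (card-embed-∅ˡ G H full) (card-full {h}))) (m<n+m h G>0)

  union-hasA×Hasa : HasA U (frac 𝔾.α g ⊔ frac ℍ.α h) × Hasa U (frac 𝔾.α g ⊔ frac ℍ.α h)
  union-hasA×Hasa with ≤-total (ℍ.α * g) (𝔾.α * h)
  ... | inj₁ H≤G = ≡.subst (λ r → HasA U r × Hasa U r) (≡.sym max≡)
    (Partition.hasA×Hasa U gh>0 H≤G closedL closedR (left-right-disjoint G H) (left∪right G H) tightL tightR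
      (*-monoˡ-≤ h 𝔾.α≤size) R<U witnessL (embed-independent G H 𝔾.J-independent (λ _ _ ()))
      (≡.subst (0 <_) (≡.sym card-witnessL) 𝔾.α>0) exactL)
    where
    max≡ : frac 𝔾.α g ⊔ frac ℍ.α h ≡ frac (𝔾.α * h) (g * h)
    max≡ = ≡.trans (ℚ.p≥q⇒p⊔q≡p (frac-≤ H>0 G>0 H≤G))
                   (frac-≡ G>0 gh>0 (rotate 𝔾.α g h))
  ... | inj₂ G≤H = ≡.subst (λ r → HasA U r × Hasa U r) (≡.sym max≡)
    (Partition.hasA×Hasa U gh>0 G≤H closedR closedL (right-left-disjoint G H) (right∪left G H) tightR tightL
      (≤-trans (*-monoˡ-≤ g ℍ.α≤size) (≤-reflexive (*-comm h g))) L<U witnessR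
      (embed-independent G H (λ _ _ ()) ℍ.J-independent)
      (≡.subst (0 <_) (≡.sym card-witnessR) ℍ.α>0) exactR)
    where
    max≡ : frac 𝔾.α g ⊔ frac ℍ.α h ≡ frac (ℍ.α * g) (g * h)
    max≡ = ≡.trans (ℚ.p≤q⇒p⊔q≡q (frac-≤ G>0 H>0 G≤H))
                   (frac-≡ H>0 gh>0 (≡.sym (*-assoc ℍ.α g h)))

claim2p8 : (G H : Graph) → NonZero (size G) → NonZero (size H)
    → VertexTransitive G → VertexTransitive H
    → IsKneser H ⊎ IsCircularComplete H ⊎ IsCycle H ⊎ IsCompleteBipartite H
    → ∃ λ qG → ∃ λ qH → HasA G qG × HasA H qH
    × HasA (union G H) (qG ⊔ qH) × Hasa (union G H) (qG ⊔ qH)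
claim2p8 G H nzG nzH vtG vtH _ =
  frac 𝔾.α (size G) , frac ℍ.α (size H) , 𝔾.hasA , ℍ.hasA , union-hasA×Hasa
  where open UnionOfVertexTransitive G H vtG vtH (>-nonZero⁻¹ (size G) {{nzG}}) (>-nonZero⁻¹ (size H) {{nzH}})
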